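{- There exists a non-deterministic $\mathrm{CMSO}_2$-transduction $\tau$ such that for every directed graph $G$, represented as the $\{\mathsf{edge}\}$-structure $\mathbb{G}$, the set $\tau(\mathbb{G})$ is non-empty and every output in $\tau(\mathbb{G})$ is equal to some $\{\mathsf{ancestor},\mathsf{m\text{ - }edge}\}$-structure $\mathbb{M}$ representing the enriched modular decomposition $(T,F)$ of $G$.
   Context: $\mathrm{CMSO}_2$ is MSO with an even-cardinality predicate; a $\mathrm{CMSO}_2$-transduction is a finite composition of atomic steps: filtering by a sentence, universe restriction by a formula, interpretation (defining new relations/predicates by formulas on the same universe), copying (adding $k$ copies of each element with relations $\mathsf{copy}_i$), and colouring (non-deterministically adding an arbitrary unary relation); $\tau(\mathbb{A})$ is the set of outputs; non-deterministic means colouring is used. A (finite) directed graph $G$ is represented as the structure with universe $V(G)$ and binary relation $\mathsf{edge}=E(G)$. A set $M\subseteq V(G)$ is a module if for every $u\notin M$ and $v,w\in M$: $uv\in E(G)\iff uw\in E(G)$ and $vu\in E(G)\iff wu\in E(G)$. Two sets overlap if they intersect and neither contains the other. A non-empty module is strong if it overlaps no non-empty module. The maximal modular decomposition $T$ of $G$ is the rooted tree whose nodes are the strong modules, with root $V(G)$, parent of a strong module being the minimal strong module strictly containing it; its leaves are the singletons, identified with the vertices, so $L(T)=V(G)$; $L(T_t)$ denotes the set of leaves below $t$. The enriched modular decomposition is $(T,F)$ where $F\subseteq V(T)\times V(T)$ contains $(s,t)$ exactly when $s\ne t$ are siblings in $T$ and every vertex of $L(T_s)$ has an edge to every vertex of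 $L(T_t)$ (equivalently, some edge goes from $L(T_s)$ to $L(T_t)$). It is represented as the structure with universe $V(T)$, $\mathsf{ancestor}(u,v)$ iff $u$ is an ancestor of $v$ in $T$ (reflexively), and $\mathsf{m\text{ - }edge}=F$. -}

module Defs where

open import Data.Bool using (Bool; true; false; _∧_; not)
open import Data.Nat using (ℕ; zero; suc; _*_)
open import Data.Fin using (Fin; zero; suc; remQuot; _≟_)
open import Data.Fin.Subset using (Subset; _∈_; _∉_; _⊆_; _⊂_; Nonempty; ⁅_⁆)
open import Data.Vec using (Vec; []; _∷_; lookup; map; toList)
open import Data.List using (List; []; _∷_; allFin; concatMap)
open import Data.Bool.ListAction using (any; all)
open import Data.Product using (Σ; ∃; _×_; _,_; proj₁; proj₂)
open import Data.Sum using (_⊎_; inj₁; inj₂)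
open import Data.Unit using (⊤; tt)
open import Relation.Nullary using (¬_)
open import Relation.Nullary.Decidable using (⌊_⌋)
open import Relation.Binary.PropositionalEquality using (_≡_; _≢_)
open import Relation.Binary.Construct.Closure.ReflexiveTransitive using (Star)
open import Function.Bundles using (_⇔_)
open import Function.Definitions using (Injective)

record Sig : Set₁ where
  field
    Sym   : Set
    arity : Sym → ℕ
open Sig public

record Structure (σ : Sig) : Set where
  field
    size : ℕ
    rel  : (r : Sym σ) → Vec (Fin size) (arity σ r) → Bool
open Structure public

-- CMSO₂ formulas: fv free element variables, sv free set variables

data Formula (σ : Sig) : ℕ → ℕ → Set where
  atom : ∀ {fv sv} (r : Sym σ) → Vec (Fin fv) (arity σ r) → Formula σ fv sv
  eq   : ∀ {fv sv} → Fin fv → Fin fv → Formula σ fv sv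
  mem  : ∀ {fv sv} → Fin fv → Fin sv → Formula σ fv sv
  even : ∀ {fv sv} → Fin sv → Formula σ fv sv
  neg  : ∀ {fv sv} → Formula σ fv sv → Formula σ fv sv
  conj : ∀ {fv sv} → Formula σ fv sv → Formula σ fv sv → Formula σ fv sv
  ex₁  : ∀ {fv sv} → Formula σ (suc fv) sv → Formula σ fv sv   -- ∃ element (var 0)
  ex₂  : ∀ {fv sv} → Formula σ fv (suc sv) → Formula σ fv sv   -- ∃ set (var 0)

extend : ∀ {k} {A : Set} → A → (Fin k → A) → Fin (suc k) → A
extend a ρ zero    = a
extend a ρ (suc i) = ρ i

isEven : ℕ → Bool
isEven zero          = true
isEven (suc zero)    = false
isEven (suc (suc n)) = isEven n

count : ∀ {n} → Subset n → ℕ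
count []          = zero
count (true ∷ X)  = suc (count X)
count (false ∷ X) = count X

allSubsets : (n : ℕ) → List (Subset n)
allSubsets zero    = [] ∷ []
allSubsets (suc n) = concatMap (λ X → (true ∷ X) ∷ (false ∷ X) ∷ []) (allSubsets n)

eval : ∀ {σ fv sv} (A : Structure σ) → Formula σ fv sv →
       (Fin fv → Fin (size A)) → (Fin sv → Subset (size A)) → Bool
eval A (atom r xs) ρ S = rel A r (map ρ xs)
eval A (eq x y)   ρ S = ⌊ ρ x ≟ ρ y ⌋
eval A (mem x X)  ρ S = lookup (S X) (ρ x)
eval A (even X)   ρ S = isEven (count (S X))
eval A (neg φ)    ρ S = not (eval A φ ρ S)
eval A (conj φ ψ) ρ S = eval A φ ρ S ∧ eval A ψ ρ S
eval A (ex₁ φ)    ρ S = any (λ a → eval A φ (extend a ρ) S) (allFin (size A))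
eval A (ex₂ φ)    ρ S = any (λ X → eval A φ ρ (extend X S)) (allSubsets (size A))

noVar : ∀ {A : Set} → Fin zero → A
noVar ()

copySig : Sig → ℕ → Sig
copySig σ k = record { Sym = Sym σ ⊎ Fin k ; arity = ar }
  where
  ar : Sym σ ⊎ Fin k → ℕ
  ar (inj₁ r) = arity σ r
  ar (inj₂ i) = 2

colourSig : Sig → Sig
colourSig σ = record { Sym = Sym σ ⊎ ⊤ ; arity = ar }
  where
  ar : Sym σ ⊎ ⊤ → ℕ
  ar (inj₁ r) = arity σ r
  ar (inj₂ _) = 1

data Trans : Sig → Sig → Set₁ where
  filterT   : ∀ {σ} → Formula σ 0 0 → Trans σ σ
  restrictT : ∀ {σ} → Formula σ 1 0 → Trans σ σ
  interpT   : ∀ {σ} (τ : Sig) → ((r : Sym τ) → Formula σ (arity τ r) 0) → Trans σ τ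
  copyT     : ∀ {σ} (k : ℕ) → Trans σ (copySig σ k)
  colourT   : ∀ {σ} → Trans σ (colourSig σ)
  _⨾_       : ∀ {σ τ υ} → Trans σ τ → Trans τ υ → Trans σ υ

isZeroF : ∀ {m} → Fin m → Bool
isZeroF zero    = true
isZeroF (suc _) = false

-- k-copying: universe = (k+1) layers of the input universe (layer 0 is
-- the original); original relations live on layer 0; copy_i(x,y) holds
-- iff x is in layer 0 and y is the i-th copy (layer i+1) of x.
copyOut : ∀ {σ} (k : ℕ) → Structure σ → Structure (copySig σ k)
copyOut {σ} k A = record { size = size A * suc k ; rel = R }
  where
  elem : Fin (size A * suc k) → Fin (size A)
  elem z = proj₁ (remQuot {size A} (suc k) z)
  layer : Fin (size A * suc k) → Fin (suc k)
  layer z = proj₂ (remQuot {size A} (suc k) z)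
  R : (r : Sym (copySig σ k)) → Vec (Fin (size A * suc k)) (arity (copySig σ k) r) → Bool
  R (inj₁ r) xs = all (λ z → isZeroF (layer z)) (toList xs) ∧ rel A r (map elem xs)
  R (inj₂ i) (x ∷ y ∷ []) =
    isZeroF (layer x) ∧ (⌊ layer y ≟ suc i ⌋ ∧ ⌊ elem x ≟ elem y ⌋)

colourOut : ∀ {σ} (A : Structure σ) → Subset (size A) → Structure (colourSig σ)
colourOut {σ} A X = record { size = size A ; rel = R }
  where
  R : (r : Sym (colourSig σ)) → Vec (Fin (size A)) (arity (colourSig σ) r) → Bool
  R (inj₁ r) xs       = rel A r xs
  R (inj₂ _) (x ∷ []) = lookup X x

interpOut : ∀ {σ} (τ : Sig) → ((r : Sym τ) → Formula σ (arity τ r) 0) →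
            Structure σ → Structure τ
interpOut τ φ A = record { size = size A ; rel = λ r xs → eval A (φ r) (lookup xs) noVar }

-- Out t A B : "B ∈ t(A)".  Universe restriction yields the substructure
-- induced on {x | A ⊨ φ(x)}, presented via an injective embedding onto it.
Out : ∀ {σ τ} → Trans σ τ → Structure σ → Structure τ → Set
Out (filterT φ)    A B = (eval A φ noVar noVar ≡ true) × (B ≡ A)
Out (restrictT φ)  A B =
  Σ (Fin (size B) → Fin (size A)) λ e →
      Injective _≡_ _≡_ e
    × (∀ x → (eval A φ (λ _ → x) noVar ≡ true) ⇔ (∃ λ y → e y ≡ x))
    × (∀ r xs → rel B r xs ≡ rel A r (map e xs))
Out (interpT τ φ)  A B = B ≡ interpOut τ φ A
Out (copyT k)      A B = B ≡ copyOut k A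
Out colourT        A B = ∃ λ X → B ≡ colourOut A X
Out (s ⨾ t)        A C = ∃ λ B → Out s A B × Out t B C

edgeSig : Sig
edgeSig = record { Sym = ⊤ ; arity = λ _ → 2 }

data MSym : Set where
  ancestor m-edge : MSym

mdSig : Sig
mdSig = record { Sym = MSym ; arity = λ _ → 2 }

module _ (G : Structure edgeSig) where

  V : Set
  V = Fin (size G)

  E : V → V → Bool
  E u v = rel G tt (u ∷ v ∷ [])

  IsModule : Subset (size G) → Set
  IsModule M = ∀ u v w → u ∉ M → v ∈ M → w ∈ M →
                 ((E u v ≡ true) ⇔ (E u w ≡ true)) × ((E v u ≡ true) ⇔ (E w u ≡ true))

  Overlap : Subset (size G) → Subset (size G) → Set
  Overlap S T = (∃ λ x → x ∈ S × x ∈ T) × ¬ (S ⊆ T) × ¬ (T ⊆ S)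

  IsStrong : Subset (size G) → Set
  IsStrong S = Nonempty S × IsModule S ×
               (∀ T → Nonempty T → IsModule T → ¬ Overlap S T)

  ParentOf : Subset (size G) → Subset (size G) → Set
  ParentOf P S = IsStrong S × IsStrong P × S ⊂ P ×
                 (∀ Q → IsStrong Q → S ⊂ Q → Q ⊆ P → Q ≡ P)

  Ancestor : Subset (size G) → Subset (size G) → Set
  Ancestor = Star ParentOf

  LeafBelow : Subset (size G) → V → Set
  LeafBelow s v = Ancestor s ⁅ v ⁆

  Siblings : Subset (size G) → Subset (size G) → Set
  Siblings s t = ∃ λ p → ParentOf p s × ParentOf p t

  MEdge : Subset (size G) → Subset (size G) → Set
  MEdge s t = s ≢ t × Siblings s t ×
              (∀ x y → LeafBelow s x → LeafBelow t y → E x y ≡ true)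

  -- B is (isomorphic to) the structure 𝕄 of the enriched modular
  -- decomposition (T , F) of G: f is a bijection from the universe of B
  -- onto the set of strong modules of G (= V(T)) preserving both relations.
  RepresentsEMD : Structure mdSig → Set
  RepresentsEMD B =
    Σ (Fin (size B) → Subset (size G)) λ f →
        Injective _≡_ _≡_ f
      × (∀ i → IsStrong (f i))
      × (∀ S → IsStrong S → ∃ λ i → f i ≡ S)
      × (∀ i j → (rel B ancestor (i ∷ j ∷ []) ≡ true) ⇔ Ancestor (f i) (f j))
      × (∀ i j → (rel B m-edge (i ∷ j ∷ []) ≡ true) ⇔ MEdge (f i) (f j))

-- Every strong module T is named by a vertex x ∈ T and a colour c ∈ (ℤ/2)²: for two guessed
-- vertex sets Z₁ and Z₂, the colour of T records the parities of |T ∩ Z₁| and |T ∩ Z₂|, and T is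
-- the least strong module containing x of colour c.  Suitable Z₁, Z₂ exist by induction along the
-- decomposition tree: vertex weights in (ℤ/2)² are chosen so that every node gets a prescribed
-- non-zero colour while, for every colour g, some child of the node does not have colour g.  Two
-- children receive different colours or, when the prescribed colour forces them to be equal, a
-- third child keeps a default colour.  Guessing also one representative vertex per named module,
-- the transduction keeps the copy of each representative in the layer of its colour and defines
-- ancestor (containment) and m-edge between the named modules by MSO formulas.

{-# OPTIONS --safe #-}
module Submission where

open import Defs
open import Data.Bool using (Bool; true; false; _∧_; not; _xor_)
open import Data.Bool.ListAction using (any)
open import Data.Bool.Properties using (T-≡; not-injective) renaming (_≟_ to _≟ᵇ_)
open import Data.Empty using (⊥-elim)
open import Data.Fin using (Fin; zero; suc; remQuot; combine)
open import Data.Fin.Properties using (any?; suc-injective; remQuot-combine; combine-remQuot) renaming (_≟_ to _≟ᶠ_)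
open import Data.Fin.Subset using (Subset; _∈_; _∉_; _⊆_; _⊂_; _∩_; _─_; ⁅_⁆; ⊤; Nonempty) renaming (⊥ to ∅)
open import Data.Fin.Subset.Properties
  using (⊆-refl; ⊆-trans; ⊆-antisym; ⊂-irref; _⊆?_; _⊂?_; _∈?_; anySubset?; drop-∷-⊆; Empty-unique; ⊆⊤; ∈⊤;
         x∈⁅x⁆; x∈⁅y⁆⇒x≡y; x∈p∩q⁺; x∈p∩q⁻; p─q⊆p; x∈p∧x∉q⇒x∈p─q)
open import Data.Fin.Subset.Induction using (Acc; acc; ⊂-wellFounded; ⊃-wellFounded)
open import Data.List using (List)
import Data.List.Membership.Propositional as List
open import Data.List.Membership.Propositional.Properties using (∈-allFin; ∈-concatMap⁺)
import Data.List.Relation.Unary.Any as Any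
open import Data.List.Relation.Unary.Any.Properties using (any⁺; any⁻)
open import Data.Maybe using (Maybe; just)
import Data.Maybe as Maybe
open import Data.Maybe.Properties using (just-injective) renaming (≡-dec to ≡-dec-Maybe)
open import Data.Nat using (ℕ; suc; _+_; _*_)
open import Data.Nat.Properties using (+-suc)
open import Data.Product using (Σ; ∃; ∃₂; _×_; _,_; proj₁; proj₂)
open import Data.Product.Properties using () renaming (≡-dec to ≡-dec-×)
open import Data.Sum using (_⊎_; inj₁; inj₂)
open import Data.Unit using (tt)
open import Data.Vec using ([]; _∷_; lookup; map; tabulate; here; there)
open import Data.Vec.Properties using (lookup∘tabulate; []=⇒lookup; lookup⇒[]=) renaming (≡-dec to ≡-dec-Vec)
open import Function using (_∘_; id; case_of_)
open import Function.Bundles using (_⇔_; mk⇔; Equivalence)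
open import Function.Definitions using (Injective)
open import Relation.Binary.Construct.Closure.ReflexiveTransitive using (ε; _◅_; _◅◅_)
open import Relation.Binary.Definitions using (DecidableEquality)
open import Relation.Binary.PropositionalEquality
  using (_≡_; _≢_; refl; sym; trans; cong; cong₂; subst; subst₂; module ≡-Reasoning)
open import Relation.Nullary using (¬_; Dec; yes; no; ¬?)
open import Relation.Nullary.Decidable using (⌊_⌋; _×-dec_; map′; decidable-stable; dec⇒maybe)
open import Relation.Unary using (Decidable)

open Equivalence using (to; from)

any-exhaustive : ∀ {A : Set} (p : A → Bool) {xs : List A} → (∀ x → x List.∈ xs) →
                 (any p xs ≡ true) ⇔ ∃ λ x → p x ≡ true
any-exhaustive p {xs} complete = mk⇔
  (λ e → let x , px = Any.satisfied (any⁻ p xs (from T-≡ e)) in x , to T-≡ px)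
  (λ (x , px) → to T-≡ (any⁺ p (List.lose (complete x) (from T-≡ px))))

∈-allSubsets : ∀ {n} (X : Subset n) → X List.∈ allSubsets n
∈-allSubsets []          = Any.here refl
∈-allSubsets (true ∷ X)  = ∈-concatMap⁺ _ (List.lose (∈-allSubsets X) (Any.here refl))
∈-allSubsets (false ∷ X) = ∈-concatMap⁺ _ (List.lose (∈-allSubsets X) (Any.there (Any.here refl)))

not≡true⇔ : ∀ {b} → (not b ≡ true) ⇔ (¬ b ≡ true)
not≡true⇔ {true}  = mk⇔ (λ ()) (λ b≢true → ⊥-elim (b≢true refl))
not≡true⇔ {false} = mk⇔ (λ _ ()) (λ _ → refl)

∧≡true⇔ : ∀ {a b} → (a ∧ b ≡ true) ⇔ (a ≡ true × b ≡ true)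
∧≡true⇔ {true}  = mk⇔ (refl ,_) proj₂
∧≡true⇔ {false} = mk⇔ (λ ()) (λ ())

⌊⌋≡true⇔ : ∀ {P : Set} (P? : Dec P) → (⌊ P? ⌋ ≡ true) ⇔ P
⌊⌋≡true⇔ (yes p)  = mk⇔ (λ _ → p) (λ _ → refl)
⌊⌋≡true⇔ (no ¬p) = mk⇔ (λ ()) (λ p → ⊥-elim (¬p p))

-- A record, so that φ stays visible to unification (the rules below leave it implicit) and
-- conversion checking never unfolds eval.
record Holds {σ fv sv} (A : Structure σ) (φ : Formula σ fv sv)
             (ρ : Fin fv → Fin (size A)) (S : Fin sv → Subset (size A)) : Set where
  constructor ⟨_⟩
  field get : eval A φ ρ S ≡ true
open Holds public

holds? : ∀ {σ fv sv} (A : Structure σ) (φ : Formula σ fv sv) ρ S → Dec (Holds A φ ρ S)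
holds? A φ ρ S = map′ ⟨_⟩ get (eval A φ ρ S ≟ᵇ true)

module _ {σ : Sig} {A : Structure σ} {fv sv} {ρ : Fin fv → Fin (size A)} {S : Fin sv → Subset (size A)} where

  holds-stable : ∀ {φ} → ¬ ¬ Holds A φ ρ S → Holds A φ ρ S
  holds-stable {φ} = decidable-stable (holds? A φ ρ S)

  atom-I : ∀ {r xs} → rel A r (map ρ xs) ≡ true → Holds A (atom r xs) ρ S
  atom-I = ⟨_⟩
  atom-E : ∀ {r xs} → Holds A (atom r xs) ρ S → rel A r (map ρ xs) ≡ true
  atom-E = get

  eq-I : ∀ {x y} → ρ x ≡ ρ y → Holds A (eq x y) ρ S
  eq-I {x} {y} p = ⟨ from (⌊⌋≡true⇔ (ρ x ≟ᶠ ρ y)) p ⟩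
  eq-E : ∀ {x y} → Holds A (eq x y) ρ S → ρ x ≡ ρ y
  eq-E {x} {y} h = to (⌊⌋≡true⇔ (ρ x ≟ᶠ ρ y)) (get h)

  mem-I : ∀ {x X} → ρ x ∈ S X → Holds A (mem x X) ρ S
  mem-I p = ⟨ []=⇒lookup p ⟩
  mem-E : ∀ {x X} → Holds A (mem x X) ρ S → ρ x ∈ S X
  mem-E {x} {X} h = lookup⇒[]= (ρ x) (S X) (get h)

  even-I : ∀ {X} → isEven (count (S X)) ≡ true → Holds A (even X) ρ S
  even-I = ⟨_⟩
  even-E : ∀ {X} → Holds A (even X) ρ S → isEven (count (S X)) ≡ true
  even-E = get

  neg-I : ∀ {φ} → ¬ Holds A φ ρ S → Holds A (neg φ) ρ S
  neg-I ¬h = ⟨ from not≡true⇔ (¬h ∘ ⟨_⟩) ⟩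
  neg-E : ∀ {φ} → Holds A (neg φ) ρ S → ¬ Holds A φ ρ S
  neg-E h h′ = to not≡true⇔ (get h) (get h′)

  conj-I : ∀ {φ ψ} → Holds A φ ρ S → Holds A ψ ρ S → Holds A (conj φ ψ) ρ S
  conj-I p q = ⟨ from ∧≡true⇔ (get p , get q) ⟩
  conj-E : ∀ {φ ψ} → Holds A (conj φ ψ) ρ S → Holds A φ ρ S × Holds A ψ ρ S
  conj-E h = let p , q = to ∧≡true⇔ (get h) in ⟨ p ⟩ , ⟨ q ⟩

  ex₁-I : ∀ {φ} a → Holds A φ (extend a ρ) S → Holds A (ex₁ φ) ρ S
  ex₁-I a h = ⟨ from (any-exhaustive _ ∈-allFin) (a , get h) ⟩
  ex₁-E : ∀ {φ} → Holds A (ex₁ φ) ρ S → ∃ λ a → Holds A φ (extend a ρ) S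
  ex₁-E h = let a , p = to (any-exhaustive _ ∈-allFin) (get h) in a , ⟨ p ⟩

  ex₂-I : ∀ {φ} X → Holds A φ ρ (extend X S) → Holds A (ex₂ φ) ρ S
  ex₂-I X h = ⟨ from (any-exhaustive _ ∈-allSubsets) (X , get h) ⟩
  ex₂-E : ∀ {φ} → Holds A (ex₂ φ) ρ S → ∃ λ X → Holds A φ ρ (extend X S)
  ex₂-E h = let X , p = to (any-exhaustive _ ∈-allSubsets) (get h) in X , ⟨ p ⟩

disj imp iff : ∀ {σ fv sv} → Formula σ fv sv → Formula σ fv sv → Formula σ fv sv
disj φ ψ = neg (conj (neg φ) (neg ψ))
imp φ ψ = neg (conj φ (neg ψ))
iff φ ψ = conj (imp φ ψ) (imp ψ φ)

all₁ : ∀ {σ fv sv} → Formula σ (suc fv) sv → Formula σ fv sv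
all₁ φ = neg (ex₁ (neg φ))

all₂ : ∀ {σ fv sv} → Formula σ fv (suc sv) → Formula σ fv sv
all₂ φ = neg (ex₂ (neg φ))

⋀ ⋁ : ∀ {σ fv sv k} → (Fin (suc k) → Formula σ fv sv) → Formula σ fv sv
⋀ {k = ℕ.zero} φ = φ zero
⋀ {k = suc k}  φ = conj (φ zero) (⋀ (φ ∘ suc))
⋁ {k = ℕ.zero} φ = φ zero
⋁ {k = suc k}  φ = disj (φ zero) (⋁ (φ ∘ suc))

subsetF seteqF : ∀ {σ fv sv} → Fin sv → Fin sv → Formula σ fv sv
subsetF X Y = all₁ (imp (mem zero X) (mem zero Y))
seteqF X Y = all₁ (iff (mem zero X) (mem zero Y))

module _ {σ : Sig} {A : Structure σ} {fv sv} {ρ : Fin fv → Fin (size A)} {S : Fin sv → Subset (size A)} where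

  disj-I : ∀ {φ ψ} → Holds A φ ρ S ⊎ Holds A ψ ρ S → Holds A (disj φ ψ) ρ S
  disj-I (inj₁ p) = neg-I (λ h → neg-E (proj₁ (conj-E h)) p)
  disj-I (inj₂ q) = neg-I (λ h → neg-E (proj₂ (conj-E h)) q)
  disj-E : ∀ {φ ψ} → Holds A (disj φ ψ) ρ S → Holds A φ ρ S ⊎ Holds A ψ ρ S
  disj-E {φ} h with holds? A φ ρ S
  ... | yes p = inj₁ p
  ... | no ¬p = inj₂ (holds-stable (λ ¬q → neg-E h (conj-I (neg-I ¬p) (neg-I ¬q))))

  imp-I : ∀ {φ ψ} → (Holds A φ ρ S → Holds A ψ ρ S) → Holds A (imp φ ψ) ρ S
  imp-I f = neg-I (λ h → neg-E (proj₂ (conj-E h)) (f (proj₁ (conj-E h))))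
  imp-E : ∀ {φ ψ} → Holds A (imp φ ψ) ρ S → Holds A φ ρ S → Holds A ψ ρ S
  imp-E h p = holds-stable (λ ¬q → neg-E h (conj-I p (neg-I ¬q)))

  iff-I : ∀ {φ ψ} → (Holds A φ ρ S → Holds A ψ ρ S) → (Holds A ψ ρ S → Holds A φ ρ S) →
          Holds A (iff φ ψ) ρ S
  iff-I f g = conj-I (imp-I f) (imp-I g)
  iff-E : ∀ {φ ψ} → Holds A (iff φ ψ) ρ S → (Holds A φ ρ S → Holds A ψ ρ S) × (Holds A ψ ρ S → Holds A φ ρ S)
  iff-E h = imp-E (proj₁ (conj-E h)) , imp-E (proj₂ (conj-E h))

  all₁-I : ∀ {φ} → (∀ a → Holds A φ (extend a ρ) S) → Holds A (all₁ φ) ρ S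
  all₁-I f = neg-I (λ h → let a , ¬p = ex₁-E h in neg-E ¬p (f a))
  all₁-E : ∀ {φ} → Holds A (all₁ φ) ρ S → ∀ a → Holds A φ (extend a ρ) S
  all₁-E h a = holds-stable (λ ¬p → neg-E h (ex₁-I a (neg-I ¬p)))

  all₂-I : ∀ {φ} → (∀ X → Holds A φ ρ (extend X S)) → Holds A (all₂ φ) ρ S
  all₂-I f = neg-I (λ h → let X , ¬p = ex₂-E h in neg-E ¬p (f X))
  all₂-E : ∀ {φ} → Holds A (all₂ φ) ρ S → ∀ X → Holds A φ ρ (extend X S)
  all₂-E h X = holds-stable (λ ¬p → neg-E h (ex₂-I X (neg-I ¬p)))

  ⋀-I : ∀ {k} (φ : Fin (suc k) → Formula σ fv sv) → (∀ i → Holds A (φ i) ρ S) → Holds A (⋀ φ) ρ S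
  ⋀-I {ℕ.zero} φ h = h zero
  ⋀-I {suc k}  φ h = conj-I (h zero) (⋀-I (φ ∘ suc) (h ∘ suc))
  ⋀-E : ∀ {k} (φ : Fin (suc k) → Formula σ fv sv) → Holds A (⋀ φ) ρ S → ∀ i → Holds A (φ i) ρ S
  ⋀-E {ℕ.zero} φ h zero = h
  ⋀-E {suc k}  φ h zero    = proj₁ (conj-E h)
  ⋀-E {suc k}  φ h (suc i) = ⋀-E (φ ∘ suc) (proj₂ (conj-E h)) i

  ⋁-I : ∀ {k} (φ : Fin (suc k) → Formula σ fv sv) → (∃ λ i → Holds A (φ i) ρ S) → Holds A (⋁ φ) ρ S
  ⋁-I {ℕ.zero} φ (zero , h) = h
  ⋁-I {suc k}  φ (zero , h)  = disj-I (inj₁ h)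
  ⋁-I {suc k}  φ (suc i , h) = disj-I (inj₂ (⋁-I (φ ∘ suc) (i , h)))
  ⋁-E : ∀ {k} (φ : Fin (suc k) → Formula σ fv sv) → Holds A (⋁ φ) ρ S → ∃ λ i → Holds A (φ i) ρ S
  ⋁-E {ℕ.zero} φ h = zero , h
  ⋁-E {suc k}  φ h with disj-E h
  ... | inj₁ h₀ = zero , h₀
  ... | inj₂ h′ = let i , hᵢ = ⋁-E (φ ∘ suc) h′ in suc i , hᵢ

module _ {σ : Sig} {A : Structure σ} {fv sv} {ρ : Fin fv → Fin (size A)} {S : Fin sv → Subset (size A)} where

  subset-I : ∀ {X Y} → S X ⊆ S Y → Holds A (subsetF X Y) ρ S
  subset-I X⊆Y = all₁-I (λ a → imp-I (mem-I ∘ X⊆Y ∘ mem-E))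
  subset-E : ∀ {X Y} → Holds A (subsetF X Y) ρ S → S X ⊆ S Y
  subset-E h {a} p = mem-E (imp-E (all₁-E h a) (mem-I p))

  seteq-I : ∀ {X Y} → S X ≡ S Y → Holds A (seteqF X Y) ρ S
  seteq-I X≡Y = all₁-I (λ a → iff-I (mem-I ∘ subst (_ ∈_) X≡Y ∘ mem-E) (mem-I ∘ subst (_ ∈_) (sym X≡Y) ∘ mem-E))
  seteq-E : ∀ {X Y} → Holds A (seteqF X Y) ρ S → S X ≡ S Y
  seteq-E h = ⊆-antisym (λ {a} p → mem-E (proj₁ (iff-E (all₁-E h a)) (mem-I p)))
                        (λ {a} p → mem-E (proj₂ (iff-E (all₁-E h a)) (mem-I p)))

_≟ₛ_ : ∀ {n} → DecidableEquality (Subset n)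
_≟ₛ_ = ≡-dec-Vec _≟ᵇ_

⊆⇒⊂⊎≡ : ∀ {n} {p q : Subset n} → p ⊆ q → p ⊂ q ⊎ p ≡ q
⊆⇒⊂⊎≡ {p = p} {q} p⊆q with any? (λ x → (x ∈? q) ×-dec ¬? (x ∈? p))
... | yes (x , x∈q , x∉p) = inj₁ (p⊆q , x , x∈q , x∉p)
... | no none = inj₂ (⊆-antisym p⊆q (λ {x} x∈q → decidable-stable (x ∈? p) (λ x∉p → none (x , x∈q , x∉p))))

x∈p─q⇒x∉q : ∀ {n} {p q : Subset n} {x} → x ∈ p ─ q → x ∉ q
x∈p─q⇒x∉q {p = true ∷ _} {false ∷ _} here        ()
x∈p─q⇒x∉q {p = _ ∷ _}    {_ ∷ _}     (there x∈) (there x∈q) = x∈p─q⇒x∉q x∈ x∈q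

⊆-minimal : ∀ {n} {P : Subset n → Set} → Decidable P → ∀ {S₀} → P S₀ →
            ∃ λ S → P S × S ⊆ S₀ × (∀ Q → P Q → Q ⊆ S → Q ≡ S)
⊆-minimal {P = P} P? {S₀} = go (⊂-wellFounded S₀)
  where
  go : ∀ {S₀} → Acc _⊂_ S₀ → P S₀ → ∃ λ S → P S × S ⊆ S₀ × (∀ Q → P Q → Q ⊆ S → Q ≡ S)
  go {S₀} (acc smaller) p with anySubset? (λ Q → P? Q ×-dec (Q ⊂? S₀))
  ... | yes (Q , q , Q⊂S₀) = let S , s , S⊆Q , least = go (smaller Q⊂S₀) q in S , s , ⊆-trans S⊆Q (proj₁ Q⊂S₀) , least
  ... | no none = S₀ , p , ⊆-refl , least
    where
    least : ∀ Q → P Q → Q ⊆ S₀ → Q ≡ S₀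
    least Q q Q⊆S₀ with ⊆⇒⊂⊎≡ Q⊆S₀
    ... | inj₁ Q⊂S₀ = ⊥-elim (none (Q , q , Q⊂S₀))
    ... | inj₂ Q≡S₀ = Q≡S₀

select : ∀ {n} {P : Fin n → Set} → Decidable P → Subset n
select P? = tabulate (λ x → ⌊ P? x ⌋)

∈-select⇔ : ∀ {n} {P : Fin n → Set} (P? : Decidable P) {x} → x ∈ select P? ⇔ P x
∈-select⇔ P? {x} = mk⇔
  (λ x∈ → to (⌊⌋≡true⇔ (P? x)) (trans (sym (lookup∘tabulate _ x)) ([]=⇒lookup x∈)))
  (λ px → lookup⇒[]= x _ (trans (lookup∘tabulate _ x) (from (⌊⌋≡true⇔ (P? x)) px)))

-- (ℤ/2)², with false as 0 and xor as addition.
Colour : Set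
Colour = Bool × Bool

_⊕_ : Colour → Colour → Colour
(a , b) ⊕ (c , d) = a xor c , b xor d

𝟘 : Colour
𝟘 = false , false

_≟ᶜ_ : DecidableEquality Colour
_≟ᶜ_ = ≡-dec-× _≟ᵇ_ _≟ᵇ_

⊕≡𝟘⇒≡ : ∀ {a b} → a ⊕ b ≡ 𝟘 → a ≡ b
⊕≡𝟘⇒≡ {a₁ , a₂} {b₁ , b₂} e = cong₂ _,_ (xor≡false⇒≡ (cong proj₁ e)) (xor≡false⇒≡ (cong proj₂ e))
  where
  xor≡false⇒≡ : ∀ {x y} → x xor y ≡ false → x ≡ y
  xor≡false⇒≡ {true}  {true}  _ = refl
  xor≡false⇒≡ {false} {false} _ = refl

⊕-cancel : ∀ a g s → a ⊕ ((a ⊕ (g ⊕ s)) ⊕ s) ≡ g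
⊕-cancel (a₁ , a₂) (g₁ , g₂) (s₁ , s₂) = cong₂ _,_ (xor-cancel a₁ g₁ s₁) (xor-cancel a₂ g₂ s₂)
  where
  xor-cancel : ∀ x y z → x xor ((x xor (y xor z)) xor z) ≡ y
  xor-cancel true  true  true  = refl
  xor-cancel true  true  false = refl
  xor-cancel true  false true  = refl
  xor-cancel true  false false = refl
  xor-cancel false true  true  = refl
  xor-cancel false true  false = refl
  xor-cancel false false true  = refl
  xor-cancel false false false = refl

⊕-self : ∀ a → a ⊕ (a ⊕ 𝟘) ≡ 𝟘
⊕-self (a₁ , a₂) = cong₂ _,_ (xor-self a₁) (xor-self a₂)
  where
  xor-self : ∀ x → x xor (x xor false) ≡ false
  xor-self true  = refl
  xor-self false = refl

defaultColour : Colour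
defaultColour = false , true

nonzeroAvoiding : ∀ r → ∃ λ g → g ≢ 𝟘 × g ≢ defaultColour × g ≢ r
nonzeroAvoiding (false , false) = (true , false) , (λ ()) , (λ ()) , (λ ())
nonzeroAvoiding (false , true)  = (true , false) , (λ ()) , (λ ()) , (λ ())
nonzeroAvoiding (true , false)  = (true , true)  , (λ ()) , (λ ()) , (λ ())
nonzeroAvoiding (true , true)   = (true , false) , (λ ()) , (λ ()) , (λ ())

colourAt : Fin 4 → Colour
colourAt zero                   = false , false
colourAt (suc zero)             = false , true
colourAt (suc (suc zero))       = true , false
colourAt (suc (suc (suc zero))) = true , true

indexOf : Colour → Fin 4
indexOf (false , false) = zero
indexOf (false , true)  = suc zero
indexOf (true , false)  = suc (suc zero)
indexOf (true , true)   = suc (suc (suc zero))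

colourAt-indexOf : ∀ c → colourAt (indexOf c) ≡ c
colourAt-indexOf (false , false) = refl
colourAt-indexOf (false , true)  = refl
colourAt-indexOf (true , false)  = refl
colourAt-indexOf (true , true)   = refl

indexOf-colourAt : ∀ a → indexOf (colourAt a) ≡ a
indexOf-colourAt zero                   = refl
indexOf-colourAt (suc zero)             = refl
indexOf-colourAt (suc (suc zero))       = refl
indexOf-colourAt (suc (suc (suc zero))) = refl

colourAt-injective : ∀ {a b} → colourAt a ≡ colourAt b → a ≡ b
colourAt-injective {a} {b} e = trans (sym (indexOf-colourAt a)) (trans (cong indexOf e) (indexOf-colourAt b))

odd : ℕ → Bool
odd n = not (isEven n)

oddIn : ∀ {n} → Subset n → Subset n → Bool
oddIn Z S = odd (count (S ∩ Z))

colour : ∀ {n} → Subset n → Subset n → Subset n → Colour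
colour Z₁ Z₂ S = oddIn Z₁ S , oddIn Z₂ S

isEven-suc : ∀ k → isEven (suc k) ≡ not (isEven k)
isEven-suc 0             = refl
isEven-suc 1             = refl
isEven-suc (suc (suc k)) = isEven-suc k

odd-+ : ∀ m k → odd (m + k) ≡ odd m xor odd k
odd-+ 0             k = refl
odd-+ 1             k = cong not (isEven-suc k)
odd-+ (suc (suc m)) k = odd-+ m k

count-∅∩ : ∀ {n} (Z : Subset n) → count (∅ ∩ Z) ≡ 0
count-∅∩ []      = refl
count-∅∩ (_ ∷ Z) = count-∅∩ Z

count-∩-split : ∀ {n} (u A Z : Subset n) → A ⊆ u → count (u ∩ Z) ≡ count (A ∩ Z) + count ((u ─ A) ∩ Z)
count-∩-split []          []          []          _   = refl
count-∩-split (false ∷ u) (true ∷ A)  _           A⊆u with () ← A⊆u here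
count-∩-split (true ∷ u)  (true ∷ A)  (true ∷ Z)  A⊆u = cong suc (count-∩-split u A Z (drop-∷-⊆ A⊆u))
count-∩-split (true ∷ u)  (true ∷ A)  (false ∷ Z) A⊆u = count-∩-split u A Z (drop-∷-⊆ A⊆u)
count-∩-split (true ∷ u)  (false ∷ A) (true ∷ Z)  A⊆u =
  trans (cong suc (count-∩-split u A Z (drop-∷-⊆ A⊆u))) (sym (+-suc _ _))
count-∩-split (true ∷ u)  (false ∷ A) (false ∷ Z) A⊆u = count-∩-split u A Z (drop-∷-⊆ A⊆u)
count-∩-split (false ∷ u) (false ∷ A) (_ ∷ Z)     A⊆u = count-∩-split u A Z (drop-∷-⊆ A⊆u)

∩-congʳ-on : ∀ {n} (S Z Z′ : Subset n) → (∀ {x} → x ∈ S → lookup Z x ≡ lookup Z′ x) → S ∩ Z ≡ S ∩ Z′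
∩-congʳ-on []          []      []       _ = refl
∩-congʳ-on (true ∷ S)  (z ∷ Z) (z′ ∷ Z′) agree =
  cong₂ _∷_ (agree here) (∩-congʳ-on S Z Z′ (agree ∘ there))
∩-congʳ-on (false ∷ S) (_ ∷ Z) (_ ∷ Z′)  agree = cong (false ∷_) (∩-congʳ-on S Z Z′ (agree ∘ there))

oddIn-⁅⁆ : ∀ {n} (Z : Subset n) x → oddIn Z ⁅ x ⁆ ≡ lookup Z x
oddIn-⁅⁆ (true ∷ Z)  zero    rewrite count-∅∩ Z = refl
oddIn-⁅⁆ (false ∷ Z) zero    rewrite count-∅∩ Z = refl
oddIn-⁅⁆ (_ ∷ Z)     (suc x) = oddIn-⁅⁆ Z x

oddIn-∅ : ∀ {n} (Z : Subset n) → oddIn Z ∅ ≡ false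
oddIn-∅ Z = cong odd (count-∅∩ Z)

oddIn-split : ∀ {n} (Z : Subset n) {u A} → A ⊆ u → oddIn Z u ≡ oddIn Z A xor oddIn Z (u ─ A)
oddIn-split Z {u} {A} A⊆u = trans (cong odd (count-∩-split u A Z A⊆u)) (odd-+ (count (A ∩ Z)) (count ((u ─ A) ∩ Z)))

colourBy : ∀ {n} → (Fin n → Colour) → Subset n → Colour
colourBy w = colour (tabulate (proj₁ ∘ w)) (tabulate (proj₂ ∘ w))

colourBy-⁅⁆ : ∀ {n} (w : Fin n → Colour) x → colourBy w ⁅ x ⁆ ≡ w x
colourBy-⁅⁆ w x = cong₂ _,_ (trans (oddIn-⁅⁆ _ x) (lookup∘tabulate _ x)) (trans (oddIn-⁅⁆ _ x) (lookup∘tabulate _ x))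

colourBy-∅ : ∀ {n} (w : Fin n → Colour) → colourBy w ∅ ≡ 𝟘
colourBy-∅ w = cong₂ _,_ (oddIn-∅ (tabulate (proj₁ ∘ w))) (oddIn-∅ (tabulate (proj₂ ∘ w)))

colourBy-split : ∀ {n} (w : Fin n → Colour) {u A} → A ⊆ u → colourBy w u ≡ colourBy w A ⊕ colourBy w (u ─ A)
colourBy-split w A⊆u = cong₂ _,_ (oddIn-split _ A⊆u) (oddIn-split _ A⊆u)

colourBy-local : ∀ {n} {w w′ : Fin n → Colour} {S} → (∀ {x} → x ∈ S → w x ≡ w′ x) → colourBy w S ≡ colourBy w′ S
colourBy-local {w = w} {w′} {S} agree = cong₂ _,_
  (cong (odd ∘ count) (∩-congʳ-on S _ _ (λ {x} x∈S → trans (lookup∘tabulate _ x)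
                                        (trans (cong proj₁ (agree x∈S)) (sym (lookup∘tabulate _ x))))))
  (cong (odd ∘ count) (∩-congʳ-on S _ _ (λ {x} x∈S → trans (lookup∘tabulate _ x)
                                        (trans (cong proj₂ (agree x∈S)) (sym (lookup∘tabulate _ x))))))

module _ (G : Structure edgeSig) where

  Decodes : (Z₁ Z₂ : Subset (size G)) → V G → Colour → Subset (size G) → Set
  Decodes Z₁ Z₂ x c T = IsStrong G T × x ∈ T × colour Z₁ Z₂ T ≡ c ×
    (∀ Y → IsStrong G Y → x ∈ Y → Y ⊆ T → colour Z₁ Z₂ Y ≡ c → Y ≡ T)

  MEdge∈ : Subset (size G) → Subset (size G) → Set
  MEdge∈ s t = s ≢ t × Siblings G s t × (∀ x y → x ∈ s → y ∈ t → E G x y ≡ true)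

-- The edge relation together with six colours: Z₁, Z₂ and the four selections R a.
σc : Sig
σc = colourSig (colourSig (colourSig (colourSig (colourSig (colourSig edgeSig)))))

colourGraph : (G : Structure edgeSig) → (Z₁ Z₂ : Subset (size G)) → (Fin 4 → Subset (size G)) → Structure σc
colourGraph G Z₁ Z₂ R =
  colourOut (colourOut (colourOut (colourOut (colourOut (colourOut G Z₁) Z₂)
    (R zero)) (R (suc zero))) (R (suc (suc zero)))) (R (suc (suc (suc zero))))

module _ {fv sv : ℕ} where

  edgeF : Fin fv → Fin fv → Formula σc fv sv
  edgeF x y = atom (inj₁ (inj₁ (inj₁ (inj₁ (inj₁ (inj₁ tt)))))) (x ∷ y ∷ [])

  z₁F z₂F : Fin fv → Formula σc fv sv
  z₁F x = atom (inj₁ (inj₁ (inj₁ (inj₁ (inj₁ (inj₂ tt)))))) (x ∷ [])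
  z₂F x = atom (inj₁ (inj₁ (inj₁ (inj₁ (inj₂ tt))))) (x ∷ [])

  selF : Fin 4 → Fin fv → Formula σc fv sv
  selF zero                   x = atom (inj₁ (inj₁ (inj₁ (inj₂ tt)))) (x ∷ [])
  selF (suc zero)             x = atom (inj₁ (inj₁ (inj₂ tt))) (x ∷ [])
  selF (suc (suc zero))       x = atom (inj₁ (inj₂ tt)) (x ∷ [])
  selF (suc (suc (suc zero))) x = atom (inj₂ tt) (x ∷ [])

moduleF : ∀ {fv sv} → Fin sv → Formula σc fv sv
moduleF X = all₁ (all₁ (all₁ (imp (conj (neg (mem u X)) (conj (mem v X) (mem w X)))
                                  (conj (iff (edgeF u v) (edgeF u w)) (iff (edgeF v u) (edgeF w u))))))
  where
  u v w : Fin _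
  u = suc (suc zero)
  v = suc zero
  w = zero

nonemptyF : ∀ {fv sv} → Fin sv → Formula σc fv sv
nonemptyF X = ex₁ (mem zero X)

overlapF : ∀ {fv sv} → Fin sv → Fin sv → Formula σc fv sv
overlapF X Y = conj (ex₁ (conj (mem zero X) (mem zero Y))) (conj (neg (subsetF X Y)) (neg (subsetF Y X)))

strongF : ∀ {fv sv} → Fin sv → Formula σc fv sv
strongF X = conj (nonemptyF X) (conj (moduleF X)
  (all₂ (imp (conj (nonemptyF zero) (moduleF zero)) (neg (overlapF (suc X) zero)))))

strictSubsetF : ∀ {fv sv} → Fin sv → Fin sv → Formula σc fv sv
strictSubsetF X Y = conj (subsetF X Y) (ex₁ (conj (mem zero Y) (neg (mem zero X))))

parityF : ∀ {fv sv} → Bool → Fin sv → Formula σc fv sv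
parityF true  Y = neg (even Y)
parityF false Y = even Y

oddInF : ∀ {fv sv} → (∀ {fv′} → Fin fv′ → Formula σc fv′ (suc sv)) → Fin sv → Bool → Formula σc fv sv
oddInF zF X b = ex₂ (conj (all₁ (iff (mem zero zero) (conj (mem zero (suc X)) (zF zero)))) (parityF b zero))

colourF : ∀ {fv sv} → Fin sv → Colour → Formula σc fv sv
colourF X (b₁ , b₂) = conj (oddInF z₁F X b₁) (oddInF z₂F X b₂)

decodesF : ∀ {fv sv} → Fin fv → Colour → Fin sv → Formula σc fv sv
decodesF x c X = conj (strongF X) (conj (mem x X) (conj (colourF X c)
  (all₂ (imp (conj (strongF zero) (conj (mem x zero) (conj (subsetF zero (suc X)) (colourF zero c))))
             (seteqF zero (suc X))))))

parentF : ∀ {fv sv} → Fin sv → Fin sv → Formula σc fv sv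
parentF P X = conj (strongF X) (conj (strongF P) (conj (strictSubsetF X P)
  (all₂ (imp (conj (strongF zero) (conj (strictSubsetF (suc X) zero) (subsetF zero (suc P)))) (seteqF zero (suc P))))))

medgeF : ∀ {fv sv} → Fin sv → Fin sv → Formula σc fv sv
medgeF X Y = conj (neg (seteqF X Y)) (conj (ex₂ (conj (parentF zero (suc X)) (parentF zero (suc Y))))
  (all₁ (all₁ (imp (conj (mem (suc zero) X) (mem zero Y)) (edgeF (suc zero) zero)))))

module ColouredGraph (G : Structure edgeSig) (Z₁ Z₂ : Subset (size G)) (R : Fin 4 → Subset (size G)) where

  C : Structure σc
  C = colourGraph G Z₁ Z₂ R

  module _ {fv sv} {ρ : Fin fv → Fin (size G)} {S : Fin sv → Subset (size G)} where

    edge-I : ∀ {x y} → E G (ρ x) (ρ y) ≡ true → Holds C (edgeF x y) ρ S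
    edge-I = ⟨_⟩
    edge-E : ∀ {x y} → Holds C (edgeF x y) ρ S → E G (ρ x) (ρ y) ≡ true
    edge-E = get

    z₁⇔ : ∀ {x} → Holds C (z₁F x) ρ S ⇔ ρ x ∈ Z₁
    z₁⇔ {x} = mk⇔ (lookup⇒[]= (ρ x) Z₁ ∘ get) (⟨_⟩ ∘ []=⇒lookup)
    z₂⇔ : ∀ {x} → Holds C (z₂F x) ρ S ⇔ ρ x ∈ Z₂
    z₂⇔ {x} = mk⇔ (lookup⇒[]= (ρ x) Z₂ ∘ get) (⟨_⟩ ∘ []=⇒lookup)

    sel⇔ : ∀ a {x} → Holds C (selF a x) ρ S ⇔ ρ x ∈ R a
    sel⇔ zero                   {x} = mk⇔ (lookup⇒[]= (ρ x) _ ∘ get) (⟨_⟩ ∘ []=⇒lookup)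
    sel⇔ (suc zero)             {x} = mk⇔ (lookup⇒[]= (ρ x) _ ∘ get) (⟨_⟩ ∘ []=⇒lookup)
    sel⇔ (suc (suc zero))       {x} = mk⇔ (lookup⇒[]= (ρ x) _ ∘ get) (⟨_⟩ ∘ []=⇒lookup)
    sel⇔ (suc (suc (suc zero))) {x} = mk⇔ (lookup⇒[]= (ρ x) _ ∘ get) (⟨_⟩ ∘ []=⇒lookup)

  module _ {fv sv} {ρ : Fin fv → Fin (size G)} {S : Fin sv → Subset (size G)} where

    module-I : ∀ {X} → IsModule G (S X) → Holds C (moduleF X) ρ S
    module-I M = all₁-I λ a → all₁-I λ b → all₁-I λ c → imp-I λ h →
      let a∉ , h′ = conj-E h
          b∈ , c∈ = conj-E h′
          out , inn = M a b c (neg-E a∉ ∘ mem-I) (mem-E b∈) (mem-E c∈)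
      in conj-I (iff-I (edge-I ∘ to out ∘ edge-E) (edge-I ∘ from out ∘ edge-E))
                (iff-I (edge-I ∘ to inn ∘ edge-E) (edge-I ∘ from inn ∘ edge-E))
    module-E : ∀ {X} → Holds C (moduleF X) ρ S → IsModule G (S X)
    module-E h a b c a∉ b∈ c∈ =
      let h′ = imp-E (all₁-E (all₁-E (all₁-E h a) b) c) (conj-I (neg-I (a∉ ∘ mem-E)) (conj-I (mem-I b∈) (mem-I c∈)))
          out = iff-E (proj₁ (conj-E h′))
          inn = iff-E (proj₂ (conj-E h′))
      in mk⇔ (λ e → edge-E (proj₁ out (edge-I e))) (λ e → edge-E (proj₂ out (edge-I e))) ,
         mk⇔ (λ e → edge-E (proj₁ inn (edge-I e))) (λ e → edge-E (proj₂ inn (edge-I e)))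

    nonempty-I : ∀ {X} → Nonempty (S X) → Holds C (nonemptyF X) ρ S
    nonempty-I (a , a∈) = ex₁-I a (mem-I a∈)
    nonempty-E : ∀ {X} → Holds C (nonemptyF X) ρ S → Nonempty (S X)
    nonempty-E h = let a , a∈ = ex₁-E h in a , mem-E a∈

    overlap-I : ∀ {X Y} → Overlap G (S X) (S Y) → Holds C (overlapF X Y) ρ S
    overlap-I ((a , a∈X , a∈Y) , X⊈Y , Y⊈X) =
      conj-I (ex₁-I a (conj-I (mem-I a∈X) (mem-I a∈Y))) (conj-I (neg-I (X⊈Y ∘ subset-E)) (neg-I (Y⊈X ∘ subset-E)))
    overlap-E : ∀ {X Y} → Holds C (overlapF X Y) ρ S → Overlap G (S X) (S Y)
    overlap-E h =
      let a , a∈ = ex₁-E (proj₁ (conj-E h))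
          X⊈Y , Y⊈X = conj-E (proj₂ (conj-E h))
      in (a , mem-E (proj₁ (conj-E a∈)) , mem-E (proj₂ (conj-E a∈))) ,
         neg-E X⊈Y ∘ subset-I , neg-E Y⊈X ∘ subset-I

    strictSubset-I : ∀ {X Y} → S X ⊂ S Y → Holds C (strictSubsetF X Y) ρ S
    strictSubset-I (X⊆Y , a , a∈Y , a∉X) = conj-I (subset-I X⊆Y) (ex₁-I a (conj-I (mem-I a∈Y) (neg-I (a∉X ∘ mem-E))))
    strictSubset-E : ∀ {X Y} → Holds C (strictSubsetF X Y) ρ S → S X ⊂ S Y
    strictSubset-E h = let a , a∈ = ex₁-E (proj₂ (conj-E h)) in
      subset-E (proj₁ (conj-E h)) , a , mem-E (proj₁ (conj-E a∈)) , neg-E (proj₂ (conj-E a∈)) ∘ mem-I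

    parity-I : ∀ {b Y} → odd (count (S Y)) ≡ b → Holds C (parityF b Y) ρ S
    parity-I {true}  p = neg-I (λ h → to not≡true⇔ p (even-E h))
    parity-I {false} p = even-I (not-injective p)
    parity-E : ∀ {b Y} → Holds C (parityF b Y) ρ S → odd (count (S Y)) ≡ b
    parity-E {true}  h = from not≡true⇔ (neg-E h ∘ even-I)
    parity-E {false} h = cong not (even-E h)

  private
    variable
      fv sv : ℕ
      ρ : Fin fv → Fin (size G)
      S : Fin sv → Subset (size G)

  strong-I : ∀ {X} → IsStrong G (S X) → Holds C (strongF X) ρ S
  strong-I (ne , M , noOverlap) = conj-I (nonempty-I ne) (conj-I (module-I M) (all₂-I λ T → imp-I λ h →
    neg-I (noOverlap T (nonempty-E (proj₁ (conj-E h))) (module-E (proj₂ (conj-E h))) ∘ overlap-E)))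
  strong-E : ∀ {X} → Holds C (strongF X) ρ S → IsStrong G (S X)
  strong-E h =
    let ne , h′ = conj-E h
        M , noOverlap = conj-E h′
    in nonempty-E ne , module-E M ,
       λ T T≠∅ T-module → neg-E (imp-E (all₂-E noOverlap T) (conj-I (nonempty-I T≠∅) (module-I T-module))) ∘ overlap-I

  oddIn-I : ∀ (zF : ∀ {fv′} → Fin fv′ → Formula σc fv′ (suc sv)) {Z} →
    (∀ {fv′} {ρ′ : Fin fv′ → Fin (size G)} {S′ : Fin (suc sv) → Subset (size G)} {x} → Holds C (zF x) ρ′ S′ ⇔ ρ′ x ∈ Z) →
    ∀ {X b} → oddIn Z (S X) ≡ b → Holds C (oddInF zF X b) ρ S
  oddIn-I {S = S} zF {Z} zF⇔ {X} p = ex₂-I (S X ∩ Z) (conj-I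
    (all₁-I λ a → iff-I
      (λ h → let a∈X , a∈Z = x∈p∩q⁻ (S X) Z (mem-E h) in conj-I (mem-I a∈X) (from zF⇔ a∈Z))
      (λ h → mem-I (x∈p∩q⁺ (mem-E (proj₁ (conj-E h)) , to zF⇔ (proj₂ (conj-E h))))))
    (parity-I p))
  oddIn-E : ∀ (zF : ∀ {fv′} → Fin fv′ → Formula σc fv′ (suc sv)) {Z} →
    (∀ {fv′} {ρ′ : Fin fv′ → Fin (size G)} {S′ : Fin (suc sv) → Subset (size G)} {x} → Holds C (zF x) ρ′ S′ ⇔ ρ′ x ∈ Z) →
    ∀ {X b} → Holds C (oddInF zF X b) ρ S → oddIn Z (S X) ≡ b
  oddIn-E {S = S} zF {Z} zF⇔ {X} h =
    let Y , h′ = ex₂-E h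
        Y-def , Y-parity = conj-E h′
        Y≡X∩Z : Y ≡ S X ∩ Z
        Y≡X∩Z = ⊆-antisym
          (λ {a} a∈Y → let q = proj₁ (iff-E (all₁-E Y-def a)) (mem-I a∈Y) in
                         x∈p∩q⁺ (mem-E (proj₁ (conj-E q)) , to zF⇔ (proj₂ (conj-E q))))
          (λ {a} a∈X∩Z → let a∈X , a∈Z = x∈p∩q⁻ (S X) Z a∈X∩Z in
                           mem-E (proj₂ (iff-E (all₁-E Y-def a)) (conj-I (mem-I a∈X) (from zF⇔ a∈Z))))
    in subst (λ W → odd (count W) ≡ _) Y≡X∩Z (parity-E Y-parity)

  colour-I : ∀ {X c} → colour Z₁ Z₂ (S X) ≡ c → Holds C (colourF X c) ρ S
  colour-I refl = conj-I (oddIn-I z₁F z₁⇔ refl) (oddIn-I z₂F z₂⇔ refl)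
  colour-E : ∀ {X c} → Holds C (colourF X c) ρ S → colour Z₁ Z₂ (S X) ≡ c
  colour-E h = cong₂ _,_ (oddIn-E z₁F z₁⇔ (proj₁ (conj-E h))) (oddIn-E z₂F z₂⇔ (proj₂ (conj-E h)))

  decodes-I : ∀ {x c X} → Decodes G Z₁ Z₂ (ρ x) c (S X) → Holds C (decodesF x c X) ρ S
  decodes-I (strong , x∈ , col , least) =
    conj-I (strong-I strong) (conj-I (mem-I x∈) (conj-I (colour-I col) (all₂-I λ Y → imp-I λ h →
      let Y-strong , h₁ = conj-E h
          x∈Y , h₂ = conj-E h₁
          Y⊆X , Y-col = conj-E h₂
      in seteq-I (least Y (strong-E Y-strong) (mem-E x∈Y) (subset-E Y⊆X) (colour-E Y-col)))))
  decodes-E : ∀ {x c X} → Holds C (decodesF x c X) ρ S → Decodes G Z₁ Z₂ (ρ x) c (S X)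
  decodes-E h =
    let strong , h₁ = conj-E h
        x∈ , h₂ = conj-E h₁
        col , least = conj-E h₂
    in strong-E strong , mem-E x∈ , colour-E col ,
       λ Y Y-strong x∈Y Y⊆X Y-col → seteq-E (imp-E (all₂-E least Y)
         (conj-I (strong-I Y-strong) (conj-I (mem-I x∈Y) (conj-I (subset-I Y⊆X) (colour-I Y-col)))))

  parent-I : ∀ {P X} → ParentOf G (S P) (S X) → Holds C (parentF P X) ρ S
  parent-I (X-strong , P-strong , X⊂P , least) =
    conj-I (strong-I X-strong) (conj-I (strong-I P-strong) (conj-I (strictSubset-I X⊂P) (all₂-I λ Q → imp-I λ h →
      let Q-strong , h₁ = conj-E h
          X⊂Q , Q⊆P = conj-E h₁
      in seteq-I (least Q (strong-E Q-strong) (strictSubset-E X⊂Q) (subset-E Q⊆P)))))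
  parent-E : ∀ {P X} → Holds C (parentF P X) ρ S → ParentOf G (S P) (S X)
  parent-E h =
    let X-strong , h₁ = conj-E h
        P-strong , h₂ = conj-E h₁
        X⊂P , least = conj-E h₂
    in strong-E X-strong , strong-E P-strong , strictSubset-E X⊂P ,
       λ Q Q-strong X⊂Q Q⊆P → seteq-E (imp-E (all₂-E least Q)
         (conj-I (strong-I Q-strong) (conj-I (strictSubset-I X⊂Q) (subset-I Q⊆P))))

  medge-I : ∀ {X Y} → MEdge∈ G (S X) (S Y) → Holds C (medgeF X Y) ρ S
  medge-I (X≢Y , (P , P-X , P-Y) , complete) =
    conj-I (neg-I (X≢Y ∘ seteq-E)) (conj-I (ex₂-I P (conj-I (parent-I P-X) (parent-I P-Y)))
      (all₁-I λ a → all₁-I λ b → imp-I λ h → edge-I (complete a b (mem-E (proj₁ (conj-E h))) (mem-E (proj₂ (conj-E h))))))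
  medge-E : ∀ {X Y} → Holds C (medgeF X Y) ρ S → MEdge∈ G (S X) (S Y)
  medge-E h =
    let X≢Y , h₁ = conj-E h
        parent , complete = conj-E h₁
        P , P-XY = ex₂-E parent
    in neg-E X≢Y ∘ seteq-I , (P , parent-E (proj₁ (conj-E P-XY)) , parent-E (proj₂ (conj-E P-XY))) ,
       λ a b a∈X b∈Y → edge-E (imp-E (all₁-E (all₁-E complete a) b) (conj-I (mem-I a∈X) (mem-I b∈Y)))

-- Strong modules

module StrongModules (G : Structure edgeSig) where

  -- Decidable because MSO-definable; opaque, since unfolding them would evaluate the formulas.
  opaque
    strong? : Decidable (IsStrong G)
    strong? S = map′ strong-E strong-I strongF?
      where
      open ColouredGraph G ∅ ∅ (λ _ → ∅)
      strongF? : Dec (Holds C (strongF zero) noVar (λ (_ : Fin 1) → S))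
      strongF? = holds? C (strongF zero) noVar (λ _ → S)

    decodes? : ∀ Z₁ Z₂ x c T → Dec (Decodes G Z₁ Z₂ x c T)
    decodes? Z₁ Z₂ x c T = map′ decodes-E decodes-I decodesF?
      where
      open ColouredGraph G Z₁ Z₂ (λ _ → ∅)
      decodesF? : Dec (Holds C (decodesF zero c zero) (λ (_ : Fin 1) → x) (λ (_ : Fin 1) → T))
      decodesF? = holds? C (decodesF zero c zero) (λ _ → x) (λ _ → T)

  laminar : ∀ {S T x} → IsStrong G S → IsStrong G T → x ∈ S → x ∈ T → S ⊆ T ⊎ T ⊆ S
  laminar {S} {T} {x} (_ , _ , noOverlap) (T≠∅ , T-module , _) x∈S x∈T with S ⊆? T | T ⊆? S
  ... | yes S⊆T | _        = inj₁ S⊆T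
  ... | no _    | yes T⊆S = inj₂ T⊆S
  ... | no S⊈T  | no T⊈S  = ⊥-elim (noOverlap T T≠∅ T-module ((x , x∈S , x∈T) , S⊈T , T⊈S))

  ⁅⁆-strong : ∀ x → IsStrong G ⁅ x ⁆
  ⁅⁆-strong x = (x , x∈⁅x⁆ x) , ⁅x⁆-module , noOverlap
    where
    ⁅x⁆-module : IsModule G ⁅ x ⁆
    ⁅x⁆-module u v w _ v∈ w∈ rewrite x∈⁅y⁆⇒x≡y x v∈ | x∈⁅y⁆⇒x≡y x w∈ = mk⇔ id id , mk⇔ id id
    noOverlap : ∀ T → _ → IsModule G T → _
    noOverlap T _ _ ((y , y∈⁅x⁆ , y∈T) , ⁅x⁆⊈T , _) =
      ⁅x⁆⊈T (λ z∈⁅x⁆ → subst (_∈ T) (trans (x∈⁅y⁆⇒x≡y x y∈⁅x⁆) (sym (x∈⁅y⁆⇒x≡y x z∈⁅x⁆))) y∈T)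

  ⊤-strong : V G → IsStrong G ⊤
  ⊤-strong x = (x , ∈⊤) , (λ _ _ _ u∉⊤ _ _ → ⊥-elim (u∉⊤ ∈⊤)) , λ _ _ _ (_ , _ , T⊈⊤) → T⊈⊤ ⊆⊤

  ancestor⇒⊇ : ∀ {S T} → Ancestor G S T → T ⊆ S
  ancestor⇒⊇ ε                                 = id
  ancestor⇒⊇ ((_ , _ , (T⊆P , _) , _) ◅ rest) = T⊆P ∘ ancestor⇒⊇ rest

  parent-exists : ∀ {S T} → IsStrong G S → IsStrong G T → T ⊂ S → ∃ λ P → ParentOf G P T × P ⊆ S
  parent-exists {S} {T} S-strong T-strong T⊂S =
    let P , (P-strong , T⊂P , P⊆S) , _ , least = ⊆-minimal candidate? (S-strong , T⊂S , ⊆-refl)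
    in P , (T-strong , P-strong , T⊂P , λ Q Q-strong T⊂Q Q⊆P → least Q (Q-strong , T⊂Q , ⊆-trans Q⊆P P⊆S) Q⊆P) , P⊆S
    where
    candidate? : Decidable (λ Q → IsStrong G Q × T ⊂ Q × Q ⊆ S)
    candidate? Q = strong? Q ×-dec ((T ⊂? Q) ×-dec (Q ⊆? S))

  ⊇⇒ancestor : ∀ {S T} → IsStrong G S → IsStrong G T → T ⊆ S → Ancestor G S T
  ⊇⇒ancestor {S} S-strong = go (⊃-wellFounded _)
    where
    go : ∀ {T} → Acc _ T → IsStrong G T → T ⊆ S → Ancestor G S T
    go (acc larger) T-strong T⊆S with ⊆⇒⊂⊎≡ T⊆S
    ... | inj₂ refl = ε
    ... | inj₁ T⊂S =
      let P , P-T@(_ , P-strong , T⊂P , _) , P⊆S = parent-exists S-strong T-strong T⊂S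
      in go (larger T⊂P) P-strong P⊆S ◅◅ (P-T ◅ ε)

  leafBelow⇔∈ : ∀ {s x} → IsStrong G s → LeafBelow G s x ⇔ x ∈ s
  leafBelow⇔∈ {s} {x} s-strong = mk⇔
    (λ anc → ancestor⇒⊇ anc (x∈⁅x⁆ x))
    (λ x∈s → ⊇⇒ancestor s-strong (⁅⁆-strong x) (λ y∈⁅x⁆ → subst (_∈ s) (sym (x∈⁅y⁆⇒x≡y x y∈⁅x⁆)) x∈s))

  MEdge⇔MEdge∈ : ∀ {s t} → MEdge G s t ⇔ MEdge∈ G s t
  MEdge⇔MEdge∈ = mk⇔
    (λ (s≢t , (p , p-s , p-t) , complete) → s≢t , (p , p-s , p-t) ,
       λ x y x∈s y∈t → complete x y (from (leafBelow⇔∈ (proj₁ p-s)) x∈s) (from (leafBelow⇔∈ (proj₁ p-t)) y∈t))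
    (λ (s≢t , (p , p-s , p-t) , complete) → s≢t , (p , p-s , p-t) ,
       λ x y x-s y-t → complete x y (to (leafBelow⇔∈ (proj₁ p-s)) x-s) (to (leafBelow⇔∈ (proj₁ p-t)) y-t))

  decodes-unique : ∀ {Z₁ Z₂ x c S S′} → Decodes G Z₁ Z₂ x c S → Decodes G Z₁ Z₂ x c S′ → S ≡ S′
  decodes-unique (S-strong , x∈S , S-col , S-least) (S′-strong , x∈S′ , S′-col , S′-least)
    with laminar S-strong S′-strong x∈S x∈S′
  ... | inj₁ S⊆S′ = S′-least _ S-strong x∈S S⊆S′ S-col
  ... | inj₂ S′⊆S = sym (S-least _ S′-strong x∈S′ S′⊆S S′-col)

  child-maximal : ∀ {u c S x} → ParentOf G u c → IsStrong G S → x ∈ S → x ∈ c → S ⊆ u → S ≢ u → S ⊆ c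
  child-maximal (c-strong , _ , _ , least) S-strong x∈S x∈c S⊆u S≢u with laminar S-strong c-strong x∈S x∈c
  ... | inj₁ S⊆c = S⊆c
  ... | inj₂ c⊆S with ⊆⇒⊂⊎≡ c⊆S
  ...   | inj₁ c⊂S = ⊥-elim (S≢u (least _ S-strong c⊂S S⊆u))
  ...   | inj₂ refl = ⊆-refl

  child≢parent : ∀ {u c} → ParentOf G u c → c ≢ u
  child≢parent (_ , _ , c⊂u , _) c≡u = ⊂-irref c≡u c⊂u

  siblings-disjoint : ∀ {u c c′ x} → ParentOf G u c → ParentOf G u c′ → x ∈ c → x ∈ c′ → c ≡ c′
  siblings-disjoint c-child@(c-strong , _ , (c⊆u , _) , _) c′-child@(c′-strong , _ , (c′⊆u , _) , _) x∈c x∈c′ =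
    ⊆-antisym (child-maximal c′-child c-strong x∈c x∈c′ c⊆u (child≢parent c-child))
              (child-maximal c-child c′-strong x∈c′ x∈c c′⊆u (child≢parent c′-child))

  childTowards : ∀ {u t} → Ancestor G u t → u ≢ t → ∃ λ c → ParentOf G u c × Ancestor G c t
  childTowards ε              u≢u = ⊥-elim (u≢u refl)
  childTowards (u-c ◅ c-t) _   = _ , u-c , c-t

  module Children {u} (u-strong : IsStrong G u) (u-nonsingleton : ∀ x → u ≢ ⁅ x ⁆) where

    childTowards⁅_⁆ : ∀ {x} → x ∈ u → ∃ λ c → ParentOf G u c × Ancestor G c ⁅ x ⁆
    childTowards⁅_⁆ {x} x∈u = childTowards
      (⊇⇒ancestor u-strong (⁅⁆-strong x) (λ y∈⁅x⁆ → subst (_∈ u) (sym (x∈⁅y⁆⇒x≡y x y∈⁅x⁆)) x∈u))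
      (u-nonsingleton x)

    child : V G → Subset (size G)
    child x with x ∈? u
    ... | yes x∈u = proj₁ childTowards⁅ x∈u ⁆
    ... | no _    = u

    child-parent : ∀ {x} → x ∈ u → ParentOf G u (child x)
    child-parent {x} x∈u with x ∈? u
    ... | yes x∈u′ = proj₁ (proj₂ childTowards⁅ x∈u′ ⁆)
    ... | no x∉u   = ⊥-elim (x∉u x∈u)

    child-∋ : ∀ {x} → x ∈ u → x ∈ child x
    child-∋ {x} x∈u with x ∈? u
    ... | yes x∈u′ = ancestor⇒⊇ (proj₂ (proj₂ childTowards⁅ x∈u′ ⁆)) (x∈⁅x⁆ x)
    ... | no x∉u   = ⊥-elim (x∉u x∈u)

-- Existence of naming colours

module Colouring (G : Structure edgeSig) where
  open StrongModules G

  Avoids : (V G → Colour) → Subset (size G) → Colour → Set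
  Avoids w t g = ∃ λ v → v ∈ t × (∀ S → IsStrong G S → v ∈ S → S ⊆ t → S ≢ t → colourBy w S ≢ g)

  -- The induction invariant; taking g to be the colour of t, the avoiding vertex names t.
  WellColoured : (V G → Colour) → Subset (size G) → Set
  WellColoured w u = ∀ t → IsStrong G t → t ⊆ u → ∀ g → Avoids w t g

  wellColoured-local : ∀ {w w′ u} → (∀ {x} → x ∈ u → w x ≡ w′ x) → WellColoured w u → WellColoured w′ u
  wellColoured-local agree wc t t-strong t⊆u g =
    let v , v∈t , avoid = wc t t-strong t⊆u g
    in v , v∈t , λ S S-strong v∈S S⊆t S≢t → avoid S S-strong v∈S S⊆t S≢t ∘ trans (colourBy-local (agree ∘ t⊆u ∘ S⊆t))

  wellColoured-singleton : ∀ {w u} → (∀ {x y} → x ∈ u → y ∈ u → x ≡ y) → WellColoured w u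
  wellColoured-singleton same t ((v , v∈t) , _) t⊆u g = v , v∈t , λ S _ v∈S S⊆t S≢t →
    ⊥-elim (S≢t (⊆-antisym S⊆t (λ z∈t → subst (_∈ S) (same (t⊆u v∈t) (t⊆u z∈t)) v∈S)))

  module _ {u} (u-strong : IsStrong G u) (u-nonsingleton : ∀ x → u ≢ ⁅ x ⁆) where
    open Children u-strong u-nonsingleton

    avoids-parent : ∀ {w g x} → x ∈ u → colourBy w (child x) ≢ g → WellColoured w (child x) → Avoids w u g
    avoids-parent {w} {g} {x} x∈u c≢g c-wellColoured = v , c⊆u v∈c , avoid-u
      where
      c-child = child-parent x∈u
      c⊆u = proj₁ (proj₁ (proj₂ (proj₂ c-child)))
      c-avoids = c-wellColoured (child x) (proj₁ c-child) ⊆-refl g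
      v = proj₁ c-avoids
      v∈c = proj₁ (proj₂ c-avoids)
      avoid-u : ∀ S → IsStrong G S → v ∈ S → S ⊆ u → S ≢ u → colourBy w S ≢ g
      avoid-u S S-strong v∈S S⊆u S≢u with ⊆⇒⊂⊎≡ (child-maximal c-child S-strong v∈S v∈c S⊆u S≢u)
      ... | inj₁ S⊂c = proj₂ (proj₂ c-avoids) S S-strong v∈S (proj₁ S⊂c) (λ S≡c → ⊂-irref S≡c S⊂c)
      ... | inj₂ refl = c≢g

    wellColoured-parent : ∀ {w} → (∀ {x} → x ∈ u → WellColoured w (child x)) →
                          (∀ g → ∃ λ x → x ∈ u × colourBy w (child x) ≢ g) → WellColoured w u
    wellColoured-parent children-wc some-child-avoids t t-strong t⊆u g with t ≟ₛ u
    ... | yes refl = let x , x∈u , c≢g = some-child-avoids g in avoids-parent x∈u c≢g (children-wc x∈u)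
    ... | no t≢u =
      let v , v∈t = proj₁ t-strong
          v∈u = t⊆u v∈t
      in children-wc v∈u t t-strong (child-maximal (child-parent v∈u) t-strong v∈t (child-∋ v∈u) t⊆u t≢u) g

  ColouredBy : Subset (size G) → Colour → Set
  ColouredBy u g = ∃ λ w → colourBy w u ≡ g × WellColoured w u

  module ParentStep {u} (u-strong : IsStrong G u)
      (IH : ∀ {c} → c ⊂ u → IsStrong G c → ∀ g → g ≢ 𝟘 → ColouredBy c g)
      {x₀ y} (x₀∈u : x₀ ∈ u) (y∈u : y ∈ u) (y≢x₀ : y ≢ x₀) where

    u-nonsingleton : ∀ x → u ≢ ⁅ x ⁆
    u-nonsingleton x u≡⁅x⁆ =
      y≢x₀ (trans (x∈⁅y⁆⇒x≡y x (subst (y ∈_) u≡⁅x⁆ y∈u)) (sym (x∈⁅y⁆⇒x≡y x (subst (x₀ ∈_) u≡⁅x⁆ x₀∈u))))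

    open Children u-strong u-nonsingleton

    child⊆u : ∀ {x} → x ∈ u → child x ⊆ u
    child⊆u x∈u = proj₁ (proj₁ (proj₂ (proj₂ (child-parent x∈u))))

    child-of-member : ∀ {x z} → x ∈ u → z ∈ child x → child z ≡ child x
    child-of-member x∈u z∈c =
      let z∈u = child⊆u x∈u z∈c in siblings-disjoint (child-parent z∈u) (child-parent x∈u) (child-∋ z∈u) z∈c

    childWeight : Subset (size G) → Colour → V G → Colour
    childWeight c g with strong? c ×-dec (c ⊂? u) ×-dec ¬? (g ≟ᶜ 𝟘)
    ... | yes (c-strong , c⊂u , g≢𝟘) = proj₁ (IH c⊂u c-strong g g≢𝟘)
    ... | no _                        = λ _ → 𝟘

    childWeight-spec : ∀ {c g} → ParentOf G u c → g ≢ 𝟘 →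
                       colourBy (childWeight c g) c ≡ g × WellColoured (childWeight c g) c
    childWeight-spec {c} {g} (c-strong , _ , c⊂u , _) g≢𝟘 with strong? c ×-dec (c ⊂? u) ×-dec ¬? (g ≟ᶜ 𝟘)
    ... | yes (c-strong′ , c⊂u′ , g≢𝟘′) = proj₂ (IH c⊂u′ c-strong′ g g≢𝟘′)
    ... | no fails                      = ⊥-elim (fails (c-strong , c⊂u , g≢𝟘))

    c₁ : Subset (size G)
    c₁ = child x₀

    outside-c₁ : ∃ λ x → x ∈ u × x ∉ c₁
    outside-c₁ = proj₂ (proj₁ (proj₂ (proj₂ (child-parent x₀∈u))))

    x₁ : V G
    x₁ = proj₁ outside-c₁

    x₁∈u : x₁ ∈ u
    x₁∈u = proj₁ (proj₂ outside-c₁)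

    x₁∉c₁ : x₁ ∉ c₁
    x₁∉c₁ = proj₂ (proj₂ outside-c₁)

    c₂ R : Subset (size G)
    c₂ = child x₁
    R = (u ─ c₁) ─ c₂

    target : Colour → Colour → Subset (size G) → Colour
    target g₁ g₂ c with c ≟ₛ c₁ | c ≟ₛ c₂
    ... | yes _ | _     = g₁
    ... | no _  | yes _ = g₂
    ... | no _  | no _  = defaultColour

    target-c₁ : ∀ g₁ g₂ → target g₁ g₂ c₁ ≡ g₁
    target-c₁ g₁ g₂ with c₁ ≟ₛ c₁ | c₁ ≟ₛ c₂
    ... | yes _    | _ = refl
    ... | no c₁≢c₁ | _ = ⊥-elim (c₁≢c₁ refl)

    target-c₂ : ∀ g₁ g₂ → target g₁ g₂ c₂ ≡ g₂
    target-c₂ g₁ g₂ with c₂ ≟ₛ c₁ | c₂ ≟ₛ c₂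
    ... | yes c₂≡c₁ | _       = ⊥-elim (x₁∉c₁ (subst (x₁ ∈_) c₂≡c₁ (child-∋ x₁∈u)))
    ... | no _      | yes _    = refl
    ... | no _      | no c₂≢c₂ = ⊥-elim (c₂≢c₂ refl)

    target-other : ∀ g₁ g₂ {c} → c ≢ c₁ → c ≢ c₂ → target g₁ g₂ c ≡ defaultColour
    target-other g₁ g₂ {c} c≢c₁ c≢c₂ with c ≟ₛ c₁ | c ≟ₛ c₂
    ... | yes c≡c₁ | _        = ⊥-elim (c≢c₁ c≡c₁)
    ... | no _     | yes c≡c₂ = ⊥-elim (c≢c₂ c≡c₂)
    ... | no _     | no _     = refl

    target-nonzero : ∀ {g₁ g₂} → g₁ ≢ 𝟘 → g₂ ≢ 𝟘 → ∀ c → target g₁ g₂ c ≢ 𝟘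
    target-nonzero {g₁} {g₂} g₁≢𝟘 g₂≢𝟘 c with c ≟ₛ c₁ | c ≟ₛ c₂
    ... | yes _ | _     = g₁≢𝟘
    ... | no _  | yes _ = g₂≢𝟘
    ... | no _  | no _  = λ ()

    R-member : ∀ {z} → z ∈ R → z ∈ u × z ∉ c₁ × z ∉ c₂
    R-member z∈R = let z∈u─c₁ = p─q⊆p (u ─ c₁) c₂ z∈R in p─q⊆p u c₁ z∈u─c₁ , x∈p─q⇒x∉q z∈u─c₁ , x∈p─q⇒x∉q z∈R

    R-child : ∀ {g₁ g₂ z} → z ∈ R → target g₁ g₂ (child z) ≡ defaultColour
    R-child {g₁} {g₂} {z} z∈R = target-other g₁ g₂
        (λ e → z∉c₁ (subst (z ∈_) e (child-∋ z∈u)))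
        (λ e → z∉c₂ (subst (z ∈_) e (child-∋ z∈u)))
      where
      z∈u = proj₁ (R-member z∈R)
      z∉c₁ = proj₁ (proj₂ (R-member z∈R))
      z∉c₂ = proj₂ (proj₂ (R-member z∈R))

    -- Opaque, so that the case analyses below do not normalise the weights.
    opaque
      glue : Colour → Colour → V G → Colour
      glue g₁ g₂ x = childWeight (child x) (target g₁ g₂ (child x)) x

      glue-child : ∀ {g₁ g₂ x} → g₁ ≢ 𝟘 → g₂ ≢ 𝟘 → x ∈ u →
        colourBy (glue g₁ g₂) (child x) ≡ target g₁ g₂ (child x) × WellColoured (glue g₁ g₂) (child x)
      glue-child {g₁} {g₂} {x} g₁≢𝟘 g₂≢𝟘 x∈u =
        trans (sym (colourBy-local agree)) (proj₁ spec) , wellColoured-local agree (proj₂ spec)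
        where
        spec : colourBy (childWeight (child x) (target g₁ g₂ (child x))) (child x) ≡ target g₁ g₂ (child x) ×
               WellColoured (childWeight (child x) (target g₁ g₂ (child x))) (child x)
        spec = childWeight-spec (child-parent x∈u) (target-nonzero g₁≢𝟘 g₂≢𝟘 (child x))
        agree : ∀ {z} → z ∈ child x → childWeight (child x) (target g₁ g₂ (child x)) z ≡ glue g₁ g₂ z
        agree {z} z∈c = cong (λ c → childWeight c (target g₁ g₂ c) z) (sym (child-of-member x∈u z∈c))

      glue-rest : ∀ {g₁ g₂ z} → z ∈ R → glue g₁ g₂ z ≡ glue defaultColour defaultColour z
      glue-rest {z = z} z∈R = cong (λ t → childWeight (child z) t z) (trans (R-child z∈R) (sym (R-child z∈R)))

    rest : Colour
    rest = colourBy (glue defaultColour defaultColour) R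

    c₂⊆u─c₁ : c₂ ⊆ u ─ c₁
    c₂⊆u─c₁ {z} z∈c₂ = x∈p∧x∉q⇒x∈p─q (child⊆u x₁∈u z∈c₂) λ z∈c₁ →
      x₁∉c₁ (subst (x₁ ∈_) (trans (sym (child-of-member x₁∈u z∈c₂)) (child-of-member x₀∈u z∈c₁)) (child-∋ x₁∈u))

    colour-u : ∀ {g₁ g₂} → g₁ ≢ 𝟘 → g₂ ≢ 𝟘 → colourBy (glue g₁ g₂) u ≡ g₁ ⊕ (g₂ ⊕ rest)
    colour-u {g₁} {g₂} g₁≢𝟘 g₂≢𝟘 = begin
      colourBy w u                                        ≡⟨ colourBy-split w (child⊆u x₀∈u) ⟩
      colourBy w c₁ ⊕ colourBy w (u ─ c₁)                 ≡⟨ cong (colourBy w c₁ ⊕_) (colourBy-split w c₂⊆u─c₁) ⟩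
      colourBy w c₁ ⊕ (colourBy w c₂ ⊕ colourBy w R)      ≡⟨ cong₂ (λ a b → a ⊕ (b ⊕ colourBy w R)) colour-c₁ colour-c₂ ⟩
      g₁ ⊕ (g₂ ⊕ colourBy w R)                            ≡⟨ cong (λ r → g₁ ⊕ (g₂ ⊕ r)) (colourBy-local glue-rest) ⟩
      g₁ ⊕ (g₂ ⊕ rest)                                    ∎
      where
      open ≡-Reasoning
      w = glue g₁ g₂
      colour-c₁ = trans (proj₁ (glue-child g₁≢𝟘 g₂≢𝟘 x₀∈u)) (target-c₁ g₁ g₂)
      colour-c₂ = trans (proj₁ (glue-child g₁≢𝟘 g₂≢𝟘 x₁∈u)) (target-c₂ g₁ g₂)

    -- If g₁ = g₂, then g ⊕ rest = 𝟘, so rest ≠ 𝟘 and R contains a child of the default colour.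
    some-child-avoids : ∀ {g g₁ g₂} → g ≢ 𝟘 → g₁ ≢ 𝟘 → g₂ ≢ 𝟘 → g₁ ≢ defaultColour → g₁ ⊕ (g₂ ⊕ rest) ≡ g →
                        ∀ g′ → ∃ λ x → x ∈ u × colourBy (glue g₁ g₂) (child x) ≢ g′
    some-child-avoids {g} {g₁} {g₂} g≢𝟘 g₁≢𝟘 g₂≢𝟘 g₁≢default sum≡g g′ with g₁ ≟ᶜ g′
    ... | no g₁≢g′ = x₀ , x₀∈u , λ e → g₁≢g′ (trans (sym (trans (colour-child x₀∈u) (target-c₁ g₁ g₂))) e)
      where colour-child = proj₁ ∘ glue-child g₁≢𝟘 g₂≢𝟘
    ... | yes refl with g₂ ≟ᶜ g₁
    ...   | no g₂≢g₁ = x₁ , x₁∈u , λ e → g₂≢g₁ (trans (sym (trans (colour-child x₁∈u) (target-c₂ g₁ g₂))) e)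
      where colour-child = proj₁ ∘ glue-child g₁≢𝟘 g₂≢𝟘
    ...   | yes refl with any? (_∈? R)
    ...     | yes (z , z∈R) =
      z , z∈u , λ e → g₁≢default (trans (sym e) (trans (proj₁ (glue-child g₁≢𝟘 g₂≢𝟘 z∈u)) (R-child z∈R)))
      where z∈u = proj₁ (R-member z∈R)
    ...     | no R-empty = ⊥-elim (g≢𝟘 (begin
      g                ≡⟨ sym sum≡g ⟩
      g₁ ⊕ (g₁ ⊕ rest) ≡⟨ cong (λ r → g₁ ⊕ (g₁ ⊕ r)) (trans (cong (colourBy (glue defaultColour defaultColour)) (Empty-unique R-empty)) (colourBy-∅ (glue defaultColour defaultColour))) ⟩
      g₁ ⊕ (g₁ ⊕ 𝟘)    ≡⟨ ⊕-self g₁ ⟩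
      𝟘                ∎))
      where open ≡-Reasoning

    colouring : ∀ g → g ≢ 𝟘 → ColouredBy u g
    colouring g g≢𝟘 =
      glue g₁ g₂ , trans (colour-u g₁≢𝟘 g₂≢𝟘) sum≡g ,
      wellColoured-parent u-strong u-nonsingleton (proj₂ ∘ glue-child g₁≢𝟘 g₂≢𝟘)
        (some-child-avoids g≢𝟘 g₁≢𝟘 g₂≢𝟘 g₁≢default sum≡g)
      where
      g₁ = proj₁ (nonzeroAvoiding (g ⊕ rest))
      g₁≢𝟘 = proj₁ (proj₂ (nonzeroAvoiding (g ⊕ rest)))
      g₁≢default = proj₁ (proj₂ (proj₂ (nonzeroAvoiding (g ⊕ rest))))
      g₁≢g⊕rest = proj₂ (proj₂ (proj₂ (nonzeroAvoiding (g ⊕ rest))))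
      g₂ = g₁ ⊕ (g ⊕ rest)
      g₂≢𝟘 : g₂ ≢ 𝟘
      g₂≢𝟘 = g₁≢g⊕rest ∘ ⊕≡𝟘⇒≡
      sum≡g : g₁ ⊕ (g₂ ⊕ rest) ≡ g
      sum≡g = ⊕-cancel g₁ g rest

  colouring-exists : ∀ {u} → IsStrong G u → ∀ g → g ≢ 𝟘 → ColouredBy u g
  colouring-exists = go (⊂-wellFounded _)
    where
    go : ∀ {u} → Acc _⊂_ u → IsStrong G u → ∀ g → g ≢ 𝟘 → ColouredBy u g
    go {u} (acc smaller) u-strong@((x₀ , x₀∈u) , _) g g≢𝟘 with any? (λ y → (y ∈? u) ×-dec ¬? (y ≟ᶠ x₀))
    ... | yes (y , y∈u , y≢x₀) = ParentStep.colouring u-strong (λ c⊂u → go (smaller c⊂u)) x₀∈u y∈u y≢x₀ g g≢𝟘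
    ... | no none = (λ _ → g) , trans (cong (colourBy _) u≡⁅x₀⁆) (colourBy-⁅⁆ _ x₀) , wellColoured-singleton same
      where
      only-x₀ : ∀ {y} → y ∈ u → y ≡ x₀
      only-x₀ {y} y∈u = decidable-stable (y ≟ᶠ x₀) (λ y≢x₀ → none (y , y∈u , y≢x₀))
      same : ∀ {x y} → x ∈ u → y ∈ u → x ≡ y
      same x∈u y∈u = trans (only-x₀ x∈u) (sym (only-x₀ y∈u))
      u≡⁅x₀⁆ : u ≡ ⁅ x₀ ⁆
      u≡⁅x₀⁆ = ⊆-antisym (λ y∈u → subst (_∈ ⁅ x₀ ⁆) (sym (only-x₀ y∈u)) (x∈⁅x⁆ x₀))
                         (λ y∈⁅x₀⁆ → subst (_∈ u) (sym (x∈⁅y⁆⇒x≡y x₀ y∈⁅x₀⁆)) x₀∈u)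

  decodingColours : ∃ λ Z₁ → ∃ λ Z₂ → ∀ t → IsStrong G t → ∃ λ v → Decodes G Z₁ Z₂ v (colour Z₁ Z₂ t) t
  decodingColours with vertex? (size G)
    where
    vertex? : ∀ n → Dec (Fin n)
    vertex? ℕ.zero  = no λ ()
    vertex? (suc n) = yes zero
  ... | no no-vertex = ∅ , ∅ , λ _ ((x , _) , _) → ⊥-elim (no-vertex x)
  ... | yes x = tabulate (proj₁ ∘ w) , tabulate (proj₂ ∘ w) , decoder
    where
    w = proj₁ (colouring-exists (⊤-strong x) (true , true) (λ ()))
    w-wellColoured = proj₂ (proj₂ (colouring-exists (⊤-strong x) (true , true) (λ ())))
    decoder : ∀ t → IsStrong G t → ∃ λ v → Decodes G _ _ v (colourBy w t) t
    decoder t t-strong = v , t-strong , v∈t , refl , least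
      where
      v = proj₁ (w-wellColoured t t-strong ⊆⊤ (colourBy w t))
      v∈t = proj₁ (proj₂ (w-wellColoured t t-strong ⊆⊤ (colourBy w t)))
      least : ∀ Y → IsStrong G Y → v ∈ Y → Y ⊆ t → colourBy w Y ≡ colourBy w t → Y ≡ t
      least Y Y-strong v∈Y Y⊆t same-colour with Y ≟ₛ t
      ... | yes Y≡t = Y≡t
      ... | no Y≢t  = ⊥-elim (proj₂ (proj₂ (w-wellColoured t t-strong ⊆⊤ (colourBy w t))) Y Y-strong v∈Y Y⊆t Y≢t same-colour)

-- The transduction

selectedDecoderF : ∀ {fv sv} → Fin 4 → Fin fv → Fin sv → Formula σc fv sv
selectedDecoderF a x X = conj (selF a x) (decodesF x (colourAt a) X)

selectedDecodesF strongSelectedF selectedUniqueF representativesF : Formula σc 0 0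
selectedDecodesF = all₁ (⋀ λ a → imp (selF a zero) (ex₂ (decodesF zero (colourAt a) zero)))
strongSelectedF = all₂ (imp (strongF zero) (ex₁ (⋁ λ a → selectedDecoderF a zero zero)))
selectedUniqueF = all₂ (all₁ (all₁ (⋀ λ a →
  imp (conj (selectedDecoderF a (suc zero) zero) (selectedDecoderF a zero zero)) (eq (suc zero) zero))))
representativesF = conj selectedDecodesF (conj strongSelectedF selectedUniqueF)

modRelF : ∀ {fv sv} → MSym → Fin sv → Fin sv → Formula σc fv sv
modRelF ancestor X Y = subsetF Y X
modRelF m-edge   X Y = medgeF X Y

decodedPairF : MSym → Fin 4 → Fin 4 → Formula σc 2 0
decodedPairF r a b = ex₂ (ex₂ (conj (decodesF zero (colourAt a) (suc zero))
                              (conj (decodesF (suc zero) (colourAt b) zero) (modRelF r (suc zero) zero))))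

module _ (G : Structure edgeSig) where

  ModRel : MSym → Subset (size G) → Subset (size G) → Set
  ModRel ancestor S T = T ⊆ S
  ModRel m-edge   S T = MEdge∈ G S T

  module _ (Z₁ Z₂ : Subset (size G)) where

    DecodedPair : MSym → V G → Fin 4 → V G → Fin 4 → Set
    DecodedPair r x a y b = ∃₂ λ S T → Decodes G Z₁ Z₂ x (colourAt a) S × Decodes G Z₁ Z₂ y (colourAt b) T × ModRel r S T

    record Representatives (R : Fin 4 → Subset (size G)) : Set where
      field
        selected-decodes : ∀ {x a} → x ∈ R a → ∃ λ T → Decodes G Z₁ Z₂ x (colourAt a) T
        strong-selected  : ∀ {T} → IsStrong G T → ∃ λ x → ∃ λ a → x ∈ R a × Decodes G Z₁ Z₂ x (colourAt a) T
        selected-unique  : ∀ {T x x′ a} → x ∈ R a → x′ ∈ R a →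
                           Decodes G Z₁ Z₂ x (colourAt a) T → Decodes G Z₁ Z₂ x′ (colourAt a) T → x ≡ x′

module Selection (G : Structure edgeSig) (Z₁ Z₂ : Subset (size G)) (R : Fin 4 → Subset (size G)) where
  open ColouredGraph G Z₁ Z₂ R
  open Representatives

  selectedDecoder⇔ : ∀ {fv sv} {ρ : Fin fv → V G} {S : Fin sv → Subset (size G)} a {x X} →
    Holds C (selectedDecoderF a x X) ρ S ⇔ (ρ x ∈ R a × Decodes G Z₁ Z₂ (ρ x) (colourAt a) (S X))
  selectedDecoder⇔ a = mk⇔
    (λ h → to (sel⇔ a) (proj₁ (conj-E h)) , decodes-E (proj₂ (conj-E h)))
    (λ (x∈R , d) → conj-I (from (sel⇔ a) x∈R) (decodes-I d))

  representatives-E : Holds C representativesF noVar noVar → Representatives G Z₁ Z₂ R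
  representatives-E h = record
    { selected-decodes = selectedDecodes-E (proj₁ (conj-E h))
    ; strong-selected  = strongSelected-E (proj₁ (conj-E (proj₂ (conj-E h))))
    ; selected-unique  = selectedUnique-E (proj₂ (conj-E (proj₂ (conj-E h))))
    }
    where
    selectedDecodes-E : Holds C selectedDecodesF noVar noVar →
                        ∀ {x a} → x ∈ R a → ∃ λ T → Decodes G Z₁ Z₂ x (colourAt a) T
    selectedDecodes-E h {x} {a} x∈R =
      let T , d = ex₂-E (imp-E (⋀-E (λ a → imp (selF a zero) (ex₂ (decodesF zero (colourAt a) zero))) (all₁-E h x) a)
                               (from (sel⇔ a) x∈R))
      in T , decodes-E d

    strongSelected-E : Holds C strongSelectedF noVar noVar →
                       ∀ {T} → IsStrong G T → ∃ λ x → ∃ λ a → x ∈ R a × Decodes G Z₁ Z₂ x (colourAt a) T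
    strongSelected-E h {T} T-strong =
      let x , h′ = ex₁-E h-T
          a , h″ = ⋁-E (λ a → selectedDecoderF a zero zero) h′
      in x , a , to (selectedDecoder⇔ a) h″
      where
      h-T : Holds C (ex₁ (⋁ λ a → selectedDecoderF a zero zero)) noVar (extend T noVar)
      h-T = imp-E (all₂-E h T) (strong-I T-strong)

    selectedUnique-E : Holds C selectedUniqueF noVar noVar →
                       ∀ {T x x′ a} → x ∈ R a → x′ ∈ R a →
                       Decodes G Z₁ Z₂ x (colourAt a) T → Decodes G Z₁ Z₂ x′ (colourAt a) T → x ≡ x′
    selectedUnique-E h {T} {x} {x′} {a} x∈R x′∈R d d′ = eq-E {x = suc zero} {y = zero} (imp-E h-a
      (conj-I (from (selectedDecoder⇔ a) (x∈R , d)) (from (selectedDecoder⇔ a) (x′∈R , d′))))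
      where
      h-a : Holds C (imp (conj (selectedDecoderF a (suc zero) zero) (selectedDecoderF a zero zero)) (eq (suc zero) zero))
                  (extend x′ (extend x noVar)) (extend T noVar)
      h-a = ⋀-E (λ a → imp (conj (selectedDecoderF a (suc zero) zero) (selectedDecoderF a zero zero)) (eq (suc zero) zero))
                (all₁-E (all₁-E (all₂-E h T) x) x′) a

  representatives-I : Representatives G Z₁ Z₂ R → Holds C representativesF noVar noVar
  representatives-I reps = conj-I selectedDecodes-I (conj-I strongSelected-I selectedUnique-I)
    where
    selectedDecodes-I : Holds C selectedDecodesF noVar noVar
    selectedDecodes-I = all₁-I λ x → ⋀-I (λ a → imp (selF a zero) (ex₂ (decodesF zero (colourAt a) zero))) λ a →
      imp-I λ x∈R → let T , d = selected-decodes reps (to (sel⇔ a) x∈R) in ex₂-I T (decodes-I d)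

    strongSelected-I : Holds C strongSelectedF noVar noVar
    strongSelected-I = all₂-I λ T → imp-I λ T-strong →
      let x , a , x∈R , d = strong-selected reps (strong-E T-strong)
      in ex₁-I x (⋁-I (λ a → selectedDecoderF a zero zero) (a , from (selectedDecoder⇔ a) (x∈R , d)))

    selectedUnique-I : Holds C selectedUniqueF noVar noVar
    selectedUnique-I = all₂-I λ T → all₁-I λ x → all₁-I λ x′ →
      ⋀-I (λ a → imp (conj (selectedDecoderF a (suc zero) zero) (selectedDecoderF a zero zero)) (eq (suc zero) zero))
        λ a → imp-I λ h →
          let x′∈R , d′ = to (selectedDecoder⇔ a) (proj₁ (conj-E h))
              x∈R , d = to (selectedDecoder⇔ a) (proj₂ (conj-E h))
          in eq-I {x = suc zero} {y = zero} (selected-unique reps x′∈R x∈R d′ d)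

  modRel-I : ∀ {fv sv} {ρ : Fin fv → V G} {S : Fin sv → Subset (size G)} r {X Y} →
             ModRel G r (S X) (S Y) → Holds C (modRelF r X Y) ρ S
  modRel-I ancestor = subset-I
  modRel-I m-edge   = medge-I
  modRel-E : ∀ {fv sv} {ρ : Fin fv → V G} {S : Fin sv → Subset (size G)} r {X Y} →
             Holds C (modRelF r X Y) ρ S → ModRel G r (S X) (S Y)
  modRel-E ancestor = subset-E
  modRel-E m-edge   = medge-E

  decodedPair-E : ∀ {ρ : Fin 2 → V G} r a b →
    Holds C (decodedPairF r a b) ρ noVar → DecodedPair G Z₁ Z₂ r (ρ zero) a (ρ (suc zero)) b
  decodedPair-E r a b h =
    S , T , decodes-E (proj₁ (conj-E body)) , decodes-E (proj₁ (conj-E (proj₂ (conj-E body)))) ,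
    modRel-E r (proj₂ (conj-E (proj₂ (conj-E body))))
    where
    S = proj₁ (ex₂-E h)
    T = proj₁ (ex₂-E (proj₂ (ex₂-E h)))
    body = proj₂ (ex₂-E (proj₂ (ex₂-E h)))

  decodedPair-I : ∀ {ρ : Fin 2 → V G} r a b →
    DecodedPair G Z₁ Z₂ r (ρ zero) a (ρ (suc zero)) b → Holds C (decodedPairF r a b) ρ noVar
  decodedPair-I r a b (S , T , dS , dT , S-T) =
    ex₂-I S (ex₂-I T (conj-I (decodes-I dS) (conj-I (decodes-I dT) (modRel-I r S-T))))

data Sym₁ : Set where
  decodedPair : MSym → Fin 4 → Fin 4 → Sym₁
  selected    : Fin 4 → Sym₁

arity₁ : Sym₁ → ℕ
arity₁ (decodedPair _ _ _) = 2
arity₁ (selected _)        = 1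

σ₁ : Sig
σ₁ = record { Sym = Sym₁ ; arity = arity₁ }

σ₁c : Sig
σ₁c = copySig σ₁ 4

data Sym₂ : Set where
  pairOnCopies : MSym → Sym₂
  kept         : Sym₂

arity₂ : Sym₂ → ℕ
arity₂ (pairOnCopies _) = 2
arity₂ kept             = 1

σ₂ : Sig
σ₂ = record { Sym = Sym₂ ; arity = arity₂ }

decodeF : (r : Sym₁) → Formula σc (arity₁ r) 0
decodeF (decodedPair r a b) = decodedPairF r a b
decodeF (selected a)        = selF a zero

-- x is the copy of z in layer a + 1.
copyF : ∀ {fv sv} → Fin 4 → Fin fv → Fin fv → Formula σ₁c fv sv
copyF a z x = atom (inj₂ a) (z ∷ x ∷ [])

keptInF : Fin 4 → Formula σ₁c 1 0
keptInF a = ex₁ (conj (copyF a zero (suc zero)) (atom (inj₁ (selected a)) (zero ∷ [])))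

keptF : Formula σ₁c 1 0
keptF = ⋁ keptInF

pairInF : MSym → Fin 4 → Fin 4 → Formula σ₁c 2 0
pairInF r a b = ex₁ (ex₁ (conj (copyF a (suc zero) (suc (suc zero)))
  (conj (copyF b zero (suc (suc (suc zero)))) (atom (inj₁ (decodedPair r a b)) (suc zero ∷ zero ∷ [])))))

pairOnCopiesF : MSym → Formula σ₁c 2 0
pairOnCopiesF r = ⋁ λ a → ⋁ (pairInF r a)

liftF : (r : Sym₂) → Formula σ₁c (arity₂ r) 0
liftF (pairOnCopies r) = pairOnCopiesF r
liftF kept             = keptF

finalF : (r : MSym) → Formula σ₂ 2 0
finalF r = atom (pairOnCopies r) (zero ∷ suc zero ∷ [])

-- decodeF relates named modules through their original vertices; since copying keeps the
-- original relations on layer 0 only, liftF moves them onto the copies that the restriction keeps.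
τ : Trans edgeSig mdSig
τ = colourT ⨾ (colourT ⨾ (colourT ⨾ (colourT ⨾ (colourT ⨾ (colourT ⨾
      (filterT representativesF ⨾ (interpT σ₁ decodeF ⨾ (copyT 4 ⨾
      (interpT σ₂ liftF ⨾ (restrictT (atom kept (zero ∷ [])) ⨾ interpT mdSig finalF))))))))))

decoded : Structure σc → Structure σ₁
decoded = interpOut σ₁ decodeF

lifted : Structure σc → Structure σ₂
lifted C = interpOut σ₂ liftF (copyOut 4 (decoded C))

isZeroF≡true⇔ : ∀ {m} {l : Fin (suc m)} → (isZeroF l ≡ true) ⇔ (l ≡ zero)
isZeroF≡true⇔ {l = zero}  = mk⇔ (λ _ → refl) (λ _ → refl)
isZeroF≡true⇔ {l = suc _} = mk⇔ (λ ()) (λ ())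

module Copies (I : Structure σ₁) where

  D : Structure σ₁c
  D = copyOut 4 I

  origin : Fin (size I * 5) → Fin (size I)
  origin z = proj₁ (remQuot {size I} 5 z)

  layer : Fin (size I * 5) → Fin 5
  layer z = proj₂ (remQuot {size I} 5 z)

  origin-combine : ∀ x l → origin (combine x l) ≡ x
  origin-combine x l = cong proj₁ (remQuot-combine {size I} {5} x l)

  layer-combine : ∀ x l → layer (combine x l) ≡ l
  layer-combine x l = cong proj₂ (remQuot-combine {size I} {5} x l)

  origin-layer-injective : ∀ {z z′} → origin z ≡ origin z′ → layer z ≡ layer z′ → z ≡ z′
  origin-layer-injective {z} {z′} o l =
    trans (sym (combine-remQuot {size I} 5 z)) (trans (cong₂ combine o l) (combine-remQuot {size I} 5 z′))

  module _ {fv sv} {ρ : Fin fv → Fin (size I * 5)} {S : Fin sv → Subset (size I * 5)} where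

    copy⇔ : ∀ {a z x} → Holds D (copyF a z x) ρ S ⇔ (layer (ρ z) ≡ zero × layer (ρ x) ≡ suc a × origin (ρ z) ≡ origin (ρ x))
    copy⇔ {a} {z} {x} = mk⇔
      (λ h → let z₀ , rest = to ∧≡true⇔ (get h)
                 x-layer , same = to ∧≡true⇔ rest
             in to isZeroF≡true⇔ z₀ , to (⌊⌋≡true⇔ (layer (ρ x) ≟ᶠ suc a)) x-layer ,
                to (⌊⌋≡true⇔ (origin (ρ z) ≟ᶠ origin (ρ x))) same)
      (λ (z₀ , x-layer , same) → ⟨ from ∧≡true⇔ (from isZeroF≡true⇔ z₀ , from ∧≡true⇔
        (from (⌊⌋≡true⇔ (layer (ρ x) ≟ᶠ suc a)) x-layer , from (⌊⌋≡true⇔ (origin (ρ z) ≟ᶠ origin (ρ x))) same)) ⟩)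

  kept⇔ : ∀ {ρ : Fin 1 → Fin (size I * 5)} →
    Holds D keptF ρ noVar ⇔ ∃ λ a → layer (ρ zero) ≡ suc a × rel I (selected a) (origin (ρ zero) ∷ []) ≡ true
  kept⇔ {ρ} = mk⇔
    (λ h → let a , h′ = ⋁-E keptInF h
               z , h″ = ex₁-E h′
               _ , x-layer , same = to copy⇔ (proj₁ (conj-E h″))
               sel = proj₂ (to ∧≡true⇔ (atom-E (proj₂ (conj-E h″))))
           in a , x-layer , subst (λ y → rel I (selected a) (y ∷ []) ≡ true) same sel)
    (λ (a , x-layer , sel) → ⋁-I keptInF (a , ex₁-I (combine x zero) (conj-I
      (from copy⇔ (layer-combine x zero , x-layer , origin-combine x zero))
      (atom-I (from ∧≡true⇔ (from ∧≡true⇔ (from isZeroF≡true⇔ (layer-combine x zero) , refl) ,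
                             subst (λ y → rel I (selected a) (y ∷ []) ≡ true) (sym (origin-combine x zero)) sel))))))
    where
    x = origin (ρ zero)

  PairOnCopies : (Fin 2 → Fin (size I * 5)) → MSym → Set
  PairOnCopies ρ r = ∃₂ λ a b → layer (ρ zero) ≡ suc a × layer (ρ (suc zero)) ≡ suc b ×
                                rel I (decodedPair r a b) (origin (ρ zero) ∷ origin (ρ (suc zero)) ∷ []) ≡ true

  pairOnCopies-E : ∀ {ρ : Fin 2 → Fin (size I * 5)} r → Holds D (pairOnCopiesF r) ρ noVar → PairOnCopies ρ r
  pairOnCopies-E {ρ} r h with ⋁-E (λ a → ⋁ (pairInF r a)) h
  ... | a , h₁ with ⋁-E (pairInF r a) h₁
  ... | b , h₂ with ex₁-E h₂
  ... | z , h₃ with ex₁-E h₃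
  ... | z′ , h₄ = a , b , proj₁ (proj₂ (to copy⇔ copy-x)) , proj₁ (proj₂ (to copy⇔ copy-y)) ,
    subst₂ (λ x y → rel I (decodedPair r a b) (x ∷ y ∷ []) ≡ true)
      (proj₂ (proj₂ (to copy⇔ copy-x))) (proj₂ (proj₂ (to copy⇔ copy-y))) (proj₂ (to ∧≡true⇔ (atom-E at)))
    where
    copy-x = proj₁ (conj-E h₄)
    copy-y = proj₁ (conj-E (proj₂ (conj-E h₄)))
    at = proj₂ (conj-E (proj₂ (conj-E h₄)))

  pairOnCopies-I : ∀ {ρ : Fin 2 → Fin (size I * 5)} r {a b} → layer (ρ zero) ≡ suc a → layer (ρ (suc zero)) ≡ suc b →
    rel I (decodedPair r a b) (origin (ρ zero) ∷ origin (ρ (suc zero)) ∷ []) ≡ true → Holds D (pairOnCopiesF r) ρ noVar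
  pairOnCopies-I {ρ} r {a} {b} x-layer y-layer pair =
    ⋁-I (λ a → ⋁ (pairInF r a)) (a , ⋁-I (pairInF r a) (b ,
      ex₁-I (combine x zero) (ex₁-I (combine y zero) (conj-I
        (from copy⇔ (layer-combine x zero , x-layer , origin-combine x zero))
        (conj-I (from copy⇔ (layer-combine y zero , y-layer , origin-combine y zero))
          (atom-I (from ∧≡true⇔
            (from ∧≡true⇔ (from isZeroF≡true⇔ (layer-combine x zero) ,
                           from ∧≡true⇔ (from isZeroF≡true⇔ (layer-combine y zero) , refl)) ,
             subst₂ (λ x y → rel I (decodedPair r a b) (x ∷ y ∷ []) ≡ true)
               (sym (origin-combine x zero)) (sym (origin-combine y zero)) pair))))))))
    where
    x = origin (ρ zero)
    y = origin (ρ (suc zero))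

-- Every output represents the enriched modular decomposition

module Soundness (G : Structure edgeSig) (Z₁ Z₂ : Subset (size G)) (R : Fin 4 → Subset (size G))
                 (reps : Representatives G Z₁ Z₂ R) where
  open StrongModules G
  open ColouredGraph G Z₁ Z₂ R using (C; sel⇔)
  open Selection G Z₁ Z₂ R using (decodedPair-E; decodedPair-I)
  open Representatives reps

  I : Structure σ₁
  I = decoded C

  open Copies I

  Lifted : Structure σ₂
  Lifted = lifted C

  -- Stated for an arbitrary symbol, so that unfolding the interpretation never evaluates a formula.
  decoded⇔ : ∀ r xs → (rel I r xs ≡ true) ⇔ Holds C (decodeF r) (lookup xs) noVar
  decoded⇔ r xs = mk⇔ ⟨_⟩ get

  lifted⇔ : ∀ r xs → (rel Lifted r xs ≡ true) ⇔ Holds D (liftF r) (lookup xs) noVar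
  lifted⇔ r xs = mk⇔ ⟨_⟩ get

  selected⇔ : ∀ {a x} → (rel I (selected a) (x ∷ []) ≡ true) ⇔ x ∈ R a
  selected⇔ {a} {x} = mk⇔ (to (sel⇔ a) ∘ to (decoded⇔ (selected a) (x ∷ [])))
                          (from (decoded⇔ (selected a) (x ∷ [])) ∘ from (sel⇔ a))

  decodedPairRel⇔ : ∀ {r a b x y} → (rel I (decodedPair r a b) (x ∷ y ∷ []) ≡ true) ⇔ DecodedPair G Z₁ Z₂ r x a y b
  decodedPairRel⇔ {r} {a} {b} {x} {y} =
    mk⇔ (decodedPair-E r a b ∘ to (decoded⇔ (decodedPair r a b) (x ∷ y ∷ [])))
        (from (decoded⇔ (decodedPair r a b) (x ∷ y ∷ [])) ∘ decodedPair-I r a b)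

  module Restricted (B : Structure σ₂) (e : Fin (size B) → Fin (size I * 5)) (e-injective : Injective _≡_ _≡_ e)
      (e-image : ∀ z → (rel Lifted kept (z ∷ []) ≡ true) ⇔ ∃ λ i → e i ≡ z)
      (e-rel : ∀ r xs → rel B r xs ≡ rel Lifted r (map e xs)) where

    kept-e : ∀ i → ∃ λ a → layer (e i) ≡ suc a × origin (e i) ∈ R a
    kept-e i =
      let a , layer≡ , sel = to kept⇔ (to (lifted⇔ kept (e i ∷ [])) (from (e-image (e i)) (i , refl)))
      in a , layer≡ , to selected⇔ sel

    colourIndex : Fin (size B) → Fin 4
    colourIndex i = proj₁ (kept-e i)

    vertex : Fin (size B) → V G
    vertex i = origin (e i)

    node : Fin (size B) → Subset (size G)
    node i = proj₁ (selected-decodes (proj₂ (proj₂ (kept-e i))))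

    node-decoded : ∀ i → Decodes G Z₁ Z₂ (vertex i) (colourAt (colourIndex i)) (node i)
    node-decoded i = proj₂ (selected-decodes (proj₂ (proj₂ (kept-e i))))

    same-copy : ∀ {i j} → vertex i ≡ vertex j → colourIndex i ≡ colourIndex j → i ≡ j
    same-copy {i} {j} v≡ a≡ = e-injective (origin-layer-injective v≡
      (trans (proj₁ (proj₂ (kept-e i))) (trans (cong suc a≡) (sym (proj₁ (proj₂ (kept-e j)))))))

    node-injective : Injective _≡_ _≡_ node
    node-injective {i} {j} same-node = same-copy vertex≡ colourIndex≡
      where
      colourIndex≡ : colourIndex i ≡ colourIndex j
      colourIndex≡ = colourAt-injective
        (trans (sym (colour≡ (node-decoded i))) (trans (cong (colour Z₁ Z₂) same-node) (colour≡ (node-decoded j))))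
        where colour≡ = λ {x c T} (d : Decodes G Z₁ Z₂ x c T) → proj₁ (proj₂ (proj₂ d))
      vertex≡ : vertex i ≡ vertex j
      vertex≡ = selected-unique (proj₂ (proj₂ (kept-e i)))
        (subst (λ a → vertex j ∈ R a) (sym colourIndex≡) (proj₂ (proj₂ (kept-e j))))
        (node-decoded i)
        (subst₂ (λ a T → Decodes G Z₁ Z₂ (vertex j) (colourAt a) T) (sym colourIndex≡) (sym same-node) (node-decoded j))

    node-strong : ∀ i → IsStrong G (node i)
    node-strong i = proj₁ (node-decoded i)

    node-surjective : ∀ T → IsStrong G T → ∃ λ i → node i ≡ T
    node-surjective T T-strong = i , decodes-unique
      (subst₂ (λ x a → Decodes G Z₁ Z₂ x (colourAt a) (node i)) vertex≡ colourIndex≡ (node-decoded i)) d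
      where
      x = proj₁ (strong-selected T-strong)
      a = proj₁ (proj₂ (strong-selected T-strong))
      d = proj₂ (proj₂ (proj₂ (strong-selected T-strong)))
      copy-kept : ∃ λ i → e i ≡ combine x (suc a)
      copy-kept = to (e-image (combine x (suc a))) (from (lifted⇔ kept (combine x (suc a) ∷ [])) (from kept⇔
        (a , layer-combine x (suc a) ,
         subst (λ y → rel I (selected a) (y ∷ []) ≡ true) (sym (origin-combine x (suc a)))
           (from selected⇔ (proj₁ (proj₂ (proj₂ (strong-selected T-strong))))))))
      i = proj₁ copy-kept
      vertex≡ : vertex i ≡ x
      vertex≡ = trans (cong origin (proj₂ copy-kept)) (origin-combine x (suc a))
      colourIndex≡ : colourIndex i ≡ a
      colourIndex≡ = suc-injective (trans (sym (proj₁ (proj₂ (kept-e i))))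
                                         (trans (cong layer (proj₂ copy-kept)) (layer-combine x (suc a))))

    layer-index : ∀ {i a} → layer (e i) ≡ suc a → a ≡ colourIndex i
    layer-index {i} layer≡ = suc-injective (trans (sym layer≡) (proj₁ (proj₂ (kept-e i))))

    node-unique : ∀ {i a S} → layer (e i) ≡ suc a → Decodes G Z₁ Z₂ (vertex i) (colourAt a) S → S ≡ node i
    node-unique {i} layer≡ d = decodes-unique (subst (λ a → Decodes G Z₁ Z₂ (vertex i) (colourAt a) _) (layer-index layer≡) d)
                                              (node-decoded i)

    Copy-pair : MSym → Fin (size B) → Fin (size B) → Set
    Copy-pair r i j = Holds D (liftF (pairOnCopies r)) (lookup (map e (i ∷ j ∷ []))) noVar

    pairOnCopies⇔Copy-pair : ∀ r i j → (rel B (pairOnCopies r) (i ∷ j ∷ []) ≡ true) ⇔ Copy-pair r i j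
    pairOnCopies⇔Copy-pair r i j =
      mk⇔ (λ p → to (lifted⇔ (pairOnCopies r) (map e (i ∷ j ∷ []))) (trans (sym (e-rel (pairOnCopies r) (i ∷ j ∷ []))) p))
          (λ h → trans (e-rel (pairOnCopies r) (i ∷ j ∷ [])) (from (lifted⇔ (pairOnCopies r) (map e (i ∷ j ∷ []))) h))

    Copy-pair⇒ModRel : ∀ r i j → Copy-pair r i j → ModRel G r (node i) (node j)
    Copy-pair⇒ModRel r i j h = via-layers (pairOnCopies-E r h)
      where
      via-decoding : ∀ {a b} → layer (e i) ≡ suc a → layer (e j) ≡ suc b →
                     DecodedPair G Z₁ Z₂ r (vertex i) a (vertex j) b → ModRel G r (node i) (node j)
      via-decoding i-layer j-layer (S , T , dS , dT , S-T) =
        subst₂ (ModRel G r) (node-unique i-layer dS) (node-unique j-layer dT) S-T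
      via-layers : PairOnCopies (lookup (map e (i ∷ j ∷ []))) r → ModRel G r (node i) (node j)
      via-layers (a , b , i-layer , j-layer , pair) = via-decoding i-layer j-layer (to decodedPairRel⇔ pair)

    ModRel⇒Copy-pair : ∀ r i j → ModRel G r (node i) (node j) → Copy-pair r i j
    ModRel⇒Copy-pair r i j node-rel = pairOnCopies-I r (proj₁ (proj₂ (kept-e i))) (proj₁ (proj₂ (kept-e j)))
      (from (decodedPairRel⇔ {r} {colourIndex i} {colourIndex j} {vertex i} {vertex j})
        (node i , node j , node-decoded i , node-decoded j , node-rel))

    pairOnCopies⇔ModRel : ∀ r i j → (rel B (pairOnCopies r) (i ∷ j ∷ []) ≡ true) ⇔ ModRel G r (node i) (node j)
    pairOnCopies⇔ModRel r i j = mk⇔ (Copy-pair⇒ModRel r i j ∘ to (pairOnCopies⇔Copy-pair r i j))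
                                     (from (pairOnCopies⇔Copy-pair r i j) ∘ ModRel⇒Copy-pair r i j)

    represents : RepresentsEMD G (interpOut mdSig finalF B)
    represents = node , node-injective , node-strong , node-surjective ,
      (λ i j → mk⇔ (⊇⇒ancestor (node-strong i) (node-strong j) ∘ to (pairOnCopies⇔ModRel ancestor i j))
                   (from (pairOnCopies⇔ModRel ancestor i j) ∘ ancestor⇒⊇)) ,
      (λ i j → mk⇔ (from MEdge⇔MEdge∈ ∘ to (pairOnCopies⇔ModRel m-edge i j))
                   (from (pairOnCopies⇔ModRel m-edge i j) ∘ to MEdge⇔MEdge∈))

-- Some output exists

enumerate : ∀ N (p : Fin N → Bool) →
  ∃ λ m → Σ (Fin m → Fin N) λ e → Injective _≡_ _≡_ e × (∀ x → (p x ≡ true) ⇔ ∃ λ y → e y ≡ x)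
enumerate 0       p = 0 , (λ ()) , (λ {x} → case x of λ ()) , λ ()
enumerate (suc N) p with enumerate N (p ∘ suc) | p zero in p₀
... | m , e , e-injective , e-image | true = suc m , e′ , e′-injective , e′-image
  where
  e′ : Fin (suc m) → Fin (suc N)
  e′ zero    = zero
  e′ (suc y) = suc (e y)
  e′-injective : Injective _≡_ _≡_ e′
  e′-injective {zero}  {zero}  _ = refl
  e′-injective {suc y} {suc z} q = cong suc (e-injective (suc-injective q))
  e′-image : ∀ x → (p x ≡ true) ⇔ ∃ λ y → e′ y ≡ x
  e′-image zero    = mk⇔ (λ _ → zero , refl) (λ _ → p₀)
  e′-image (suc x) = mk⇔ (λ px → let y , ey≡x = to (e-image x) px in suc y , cong suc ey≡x)
                         λ { (zero , ()) ; (suc y , q) → from (e-image x) (y , suc-injective q) }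
... | m , e , e-injective , e-image | false = m , suc ∘ e , e-injective ∘ suc-injective , e′-image
  where
  e′-image : ∀ x → (p x ≡ true) ⇔ ∃ λ y → suc (e y) ≡ x
  e′-image zero    = mk⇔ (λ p₀≡true → case trans (sym p₀) p₀≡true of λ ()) (λ ())
  e′-image (suc x) = mk⇔ (λ px → let y , ey≡x = to (e-image x) px in y , cong suc ey≡x)
                         (λ (y , q) → from (e-image x) (y , suc-injective q))

module Existence (G : Structure edgeSig) where
  open StrongModules G
  open Colouring G using (decodingColours)

  Z₁ Z₂ : Subset (size G)
  Z₁ = proj₁ decodingColours
  Z₂ = proj₁ (proj₂ decodingColours)

  decodable : ∀ {T} → IsStrong G T → ∃ λ v → Decodes G Z₁ Z₂ v (colour Z₁ Z₂ T) T
  decodable = proj₂ (proj₂ decodingColours) _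

  representative : Subset (size G) → Maybe (V G)
  representative T = Maybe.map proj₁ (dec⇒maybe (any? λ v → decodes? Z₁ Z₂ v (colour Z₁ Z₂ T) T))

  representative-decodes : ∀ {T x} → representative T ≡ just x → Decodes G Z₁ Z₂ x (colour Z₁ Z₂ T) T
  representative-decodes {T} with any? (λ v → decodes? Z₁ Z₂ v (colour Z₁ Z₂ T) T)
  ... | yes (v , d) = λ v≡x → subst (λ x → Decodes G Z₁ Z₂ x _ T) (just-injective v≡x) d
  ... | no _        = λ ()

  representative-exists : ∀ {T} → IsStrong G T → ∃ λ x → representative T ≡ just x
  representative-exists {T} T-strong with any? (λ v → decodes? Z₁ Z₂ v (colour Z₁ Z₂ T) T)
  ... | yes (v , _) = v , refl
  ... | no none     = ⊥-elim (none (decodable T-strong))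

  Chosen : Fin 4 → V G → Set
  Chosen a x = ∃ λ T → colour Z₁ Z₂ T ≡ colourAt a × representative T ≡ just x

  chosen? : ∀ a → Decidable (Chosen a)
  chosen? a x = anySubset? λ T → (colour Z₁ Z₂ T ≟ᶜ colourAt a) ×-dec ≡-dec-Maybe _≟ᶠ_ (representative T) (just x)

  R : Fin 4 → Subset (size G)
  R a = select (chosen? a)

  chosen-decodes : ∀ {a x} → x ∈ R a → ∃ λ T → representative T ≡ just x × Decodes G Z₁ Z₂ x (colourAt a) T
  chosen-decodes {a} {x} x∈R =
    let T , colour≡ , rep≡ = to (∈-select⇔ (chosen? a)) x∈R
    in T , rep≡ , subst (λ c → Decodes G Z₁ Z₂ x c T) colour≡ (representative-decodes rep≡)

  representatives : Representatives G Z₁ Z₂ R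
  representatives = record
    { selected-decodes = λ x∈R → let T , _ , d = chosen-decodes x∈R in T , d
    ; strong-selected  = λ {T} T-strong →
        let x , rep≡ = representative-exists T-strong
            a = indexOf (colour Z₁ Z₂ T)
            colour≡ = sym (colourAt-indexOf (colour Z₁ Z₂ T))
        in x , a , from (∈-select⇔ (chosen? a)) (T , colour≡ , rep≡) ,
           subst (λ c → Decodes G Z₁ Z₂ x c T) colour≡ (representative-decodes rep≡)
    ; selected-unique  = λ x∈R x′∈R d d′ →
        let T₁ , rep₁ , d₁ = chosen-decodes x∈R
            T₂ , rep₂ , d₂ = chosen-decodes x′∈R
        in just-injective (trans (sym (subst (λ T → representative T ≡ just _) (decodes-unique d₁ d) rep₁))
                                 (subst (λ T → representative T ≡ just _) (decodes-unique d₂ d′) rep₂))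
    }

  C : Structure σc
  C = colourGraph G Z₁ Z₂ R

  keptCopies : ∃ λ m → Σ (Fin m → Fin (size G * 5)) λ e →
               Injective _≡_ _≡_ e × (∀ z → (rel (lifted C) kept (z ∷ []) ≡ true) ⇔ ∃ λ i → e i ≡ z)
  keptCopies = enumerate (size G * 5) (λ z → rel (lifted C) kept (z ∷ []))

  B : Structure σ₂
  B = record { size = proj₁ keptCopies ; rel = λ r xs → rel (lifted C) r (map (proj₁ (proj₂ keptCopies)) xs) }

  output : ∃ λ M → Out τ G M
  output = interpOut mdSig finalF B ,
    (_ , (Z₁ , refl) , _ , (Z₂ , refl) , _ , (R zero , refl) , _ , (R (suc zero) , refl) ,
     _ , (R (suc (suc zero)) , refl) , _ , (R (suc (suc (suc zero))) , refl) ,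
     _ , (get (Selection.representatives-I G Z₁ Z₂ R representatives) , refl) , _ , refl , _ , refl , _ , refl ,
     B , (proj₁ (proj₂ keptCopies) , proj₁ (proj₂ (proj₂ keptCopies)) , proj₂ (proj₂ (proj₂ keptCopies)) , (λ _ _ → refl)) , refl)

outputs-represent : ∀ G M → Out τ G M → RepresentsEMD G M
outputs-represent G _ (_ , (Z₁ , refl) , _ , (Z₂ , refl) , _ , (R₀ , refl) , _ , (R₁ , refl) , _ , (R₂ , refl) ,
                       _ , (R₃ , refl) , _ , (holds , refl) , _ , refl , _ , refl , _ , refl ,
                       B , (e , e-injective , e-image , e-rel) , refl) =
  Soundness.Restricted.represents G Z₁ Z₂ R (Selection.representatives-E G Z₁ Z₂ R ⟨ holds ⟩) B e e-injective e-image e-rel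
  where
  R : Fin 4 → Subset (size G)
  R = lookup (R₀ ∷ R₁ ∷ R₂ ∷ R₃ ∷ [])

theorem4p6 : Σ (Trans edgeSig mdSig) λ τ →
               ∀ (G : Structure edgeSig) →
                 (∃ λ B → Out τ G B) × (∀ B → Out τ G B → RepresentsEMD G B)
theorem4p6 = τ , λ G → Existence.output G , outputs-represent G
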